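{- Let $n\ge1$, $0\le r\le n+1$, and let $G^r_n$ be any graph obtained from the linear crossed polyomino chain $G_n$ by deleting $r$ of its vertical edges. Then the number of spanning trees of $G^r_n$ is $$\tau(G^r_n)=2^{\,2n+r+2d-10}\cdot3^{\,n-r-d+5},$$ where $d=d_1+d_{n+1}$ and $d_1,d_{n+1}$ are the degrees of vertices $1$ and $n+1$ in $G^r_n$.
   Context: For $n\geq1$, $G_n$ is the simple graph with vertex set $\{1,\ldots,n+1\}\cup\{1',\ldots,(n+1)'\}$ and edge set consisting of the vertical edges $ii'$ for $1\le i\le n+1$ together with, for each $1\le i\le n$, the edges $i(i+1)$, $i'(i+1)'$, $i(i+1)'$, $i'(i+1)$. For $0\le r\le n+1$, $\mathcal{G}^r_n$ is the set of graphs obtained from $G_n$ by deleting exactly $r$ of the vertical edges $ii'$. $\tau(G)$ is the number of spanning trees of $G$. -}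

module Defs where

open import Data.Nat using (ℕ; zero; suc; _+_)
open import Data.Bool using (Bool; true; false; not; _∧_; if_then_else_)
import Data.Bool as B
open import Data.Fin using (Fin; zero; suc; inject₁; fromℕ)
import Data.Fin as F
open import Data.Fin.Subset using (Subset)
open import Data.Vec using (lookup)
open import Data.List using (List; allFin; []; _∷_; _++_; map; concatMap; length; [_]; _∷ʳ_)
open import Data.List.Relation.Unary.All using (All)
open import Data.List.Relation.Unary.Any using (Any)
open import Data.List.Relation.Unary.AllPairs using (AllPairs)
open import Data.List.Relation.Unary.Linked using (Linked)
open import Data.List.Relation.Unary.Unique.Propositional using (Unique)

open import Data.Product using (Σ; _×_; _,_)
open import Data.Sum using (_⊎_)
open import Relation.Binary.PropositionalEquality using (_≡_)
open import Relation.Binary.Construct.Closure.ReflexiveTransitive using (Star)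
open import Relation.Nullary using (¬_)
open import Relation.Nullary.Decidable using (⌊_⌋)
open import Data.Nat using (_≤_)
open import Data.Empty using (⊥)

-- The linear crossed polyomino chain G_n.
-- Vertex (i , false) is the paper's vertex (i+1), (i , true) is (i+1)'
-- (i : Fin (n+1), so paper indices 1..n+1 correspond to 0..n).

Vertex : ℕ → Set
Vertex n = Fin (suc n) × Bool

-- Edges of G_n:
--   vert i        : the vertical edge  i i'
--   horiz i a b   : the edge between (i , a) and (i+1 , b), i.e. for the
--                   four choices of (a , b) the edges i(i+1), i(i+1)',
--                   i'(i+1), i'(i+1)'.
data Edge (n : ℕ) : Set where
  vert  : Fin (suc n) → Edge n
  horiz : Fin n → Bool → Bool → Edge n

ends : ∀ {n} → Edge n → Vertex n × Vertex n
ends (vert i)      = (i , false) , (i , true)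
ends (horiz i a b) = (inject₁ i , a) , (suc i , b)

allEdges : (n : ℕ) → List (Edge n)
allEdges n = map vert (allFin (suc n))
          ++ concatMap (λ i → horiz i false false ∷ horiz i false true
                            ∷ horiz i true false ∷ horiz i true true ∷ [])
                       (allFin n)

-- G^r_n : determined by the set D ⊆ {1..n+1} of deleted vertical edges
-- (a Subset (suc n)); r = ∣ D ∣.

present : ∀ {n} → Subset (suc n) → Edge n → Bool
present D (vert i)      = not (lookup D i)
present D (horiz _ _ _) = true

_==ᵥ_ : ∀ {n} → Vertex n → Vertex n → Bool
(i , a) ==ᵥ (j , b) = ⌊ i F.≟ j ⌋ ∧ ⌊ a B.≟ b ⌋

incident : ∀ {n} → Vertex n → Edge n → Bool
incident v e with ends e
... | u , w = if v ==ᵥ u then true else (v ==ᵥ w)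

countᵇ : ∀ {A : Set} → (A → Bool) → List A → ℕ
countᵇ p []       = 0
countᵇ p (x ∷ xs) = if p x then suc (countᵇ p xs) else countᵇ p xs

degree : ∀ {n} → Subset (suc n) → Vertex n → ℕ
degree {n} D v = countᵇ (λ e → present D e ∧ incident v e) (allEdges n)

-- Spanning trees. An edge set is a Boolean predicate on edges; two edge
-- sets are the same iff they agree pointwise.

EdgeSet : ℕ → Set
EdgeSet n = Edge n → Bool

_≐_ : ∀ {n} → EdgeSet n → EdgeSet n → Set
T ≐ U = ∀ e → T e ≡ U e

Adj : ∀ {n} → EdgeSet n → Vertex n → Vertex n → Set
Adj {n} T u v = Σ (Edge n) λ e → T e ≡ true × (ends e ≡ (u , v) ⊎ ends e ≡ (v , u))

Connected : ∀ {n} → EdgeSet n → Set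
Connected {n} T = (u v : Vertex n) → Star (Adj T) u v

IsCycle : ∀ {n} → EdgeSet n → List (Vertex n) → Set
IsCycle T []       = ⊥
IsCycle T (v ∷ vs) = 3 ≤ length (v ∷ vs) × Unique (v ∷ vs) × Linked (Adj T) ((v ∷ vs) ∷ʳ v)

Acyclic : ∀ {n} → EdgeSet n → Set
Acyclic {n} T = (vs : List (Vertex n)) → ¬ IsCycle T vs

SpanningTree : ∀ {n} → Subset (suc n) → EdgeSet n → Set
SpanningTree D T = (∀ e → T e ≡ true → present D e ≡ true) × Connected T × Acyclic T

-- "exactly k edge sets satisfy P" (counted up to pointwise equality)
NumberOf : ∀ {n} → (EdgeSet n → Set) → ℕ → Set
NumberOf {n} P k =
  Σ (List (EdgeSet n)) λ L →
    length L ≡ k × All P L × AllPairs (λ T U → ¬ (T ≐ U)) L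
    × (∀ T → P T → Any (T ≐_) L)

v₁ : ∀ {n} → Vertex n
v₁ = zero , false

vₙ₊₁ : ∀ {n} → Vertex n
vₙ₊₁ {n} = fromℕ n , false

-- Write G^D for G_n with the rungs (vertical edges) listed in D deleted.
-- An edge set of G_{m+1} is a choice L of the five edges meeting column 0
-- (its rung and four links to column 1) plus an edge set t of a shifted
-- copy of G_m. A spanning tree of G^{d ∷ D} restricts to a spanning tree of
-- G^D when column 0 does not join the two vertices of column 1, and otherwise
-- to a split forest of G^D (two trees separating the ends of its first rung).
-- Which L complete which kind of rest only depends on a 4-vertex local graph,
-- so it is decided by evaluation on all 32 choices of L, using Boolean path
-- searches and cut certificates that transfer lemmas turn into paths and
-- separations of the whole graph. Counting completions gives the recurrence
--   τ(d ∷ D) = c_d (τ(D) + φ(D)),  φ(d ∷ D) = 4 (τ(D) + φ(D)),  c_d ∈ {8, 4},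
-- hence a closed form for τ + φ; with the end degrees (2 or 3 according as
-- the end rung is deleted) this is the stated formula.

module Submission where

open import Defs
open import Data.Nat using (ℕ; zero; suc; _+_; _*_; _^_; _≤_; s≤s; z≤n)
import Data.Nat.Properties as ℕP
open import Data.Nat.Tactic.RingSolver using (solve-∀)
open import Data.Bool using (Bool; true; false; not; _∧_; _∨_; T; if_then_else_)
import Data.Bool as Bool
open import Data.Bool.ListAction using (all; any)
open import Data.Bool.Properties using (∧-zeroʳ; ∧-identityʳ; T-∧; T-∨; T-≡; T-not-≡)
open import Data.Fin using (Fin; zero; suc; inject₁; toℕ)
import Data.Fin as Fin
import Data.Fin.Properties as FinP
open import Data.Fin.Subset using (Subset; ∣_∣)
open import Data.List
  using ( List; []; _∷_; _++_; _∷ʳ_; length; map; filter; concat; concatMap; tabulate; allFin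
        ; cartesianProduct; cartesianProductWith)
open import Data.List.Properties using (length-++; length-map; map-tabulate; concat-map; map-∘)
open import Data.List.Membership.Propositional using (_∈_)
open import Data.List.Membership.Propositional.Properties using (∈-cartesianProduct⁺; ∈-allFin; ∈-filter⁺)
open import Data.List.Membership.DecPropositional using () renaming (_∈?_ to member?)
open import Data.List.Relation.Unary.All as All using (All; []; _∷_)
import Data.List.Relation.Unary.All.Properties as AllP
open import Data.List.Relation.Unary.Any as Any using (Any; here; there)
import Data.List.Relation.Unary.Any.Properties as AnyP
open import Data.List.Relation.Unary.AllPairs as AllPairs using (AllPairs; []; _∷_)
import Data.List.Relation.Unary.AllPairs.Properties as AllPairsP
open import Data.List.Relation.Unary.Linked as Linked using (Linked; [-]; _∷_)
open import Data.List.Relation.Unary.Unique.Propositional using (Unique)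
open import Data.List.Relation.Unary.Unique.Propositional.Properties using (cartesianProduct⁺)
open import Data.Vec using ([]; _∷_)
open import Data.Product using (Σ; _×_; _,_; proj₁; proj₂)
open import Data.Product.Properties using (≡-dec; ,-injective)
open import Data.Sum using (_⊎_; inj₁; inj₂; [_,_]′)
open import Data.Empty using (⊥; ⊥-elim)
open import Function using (_∘_; id; case_of_)
open import Function.Bundles using (Equivalence)
open import Relation.Binary.PropositionalEquality
open import Relation.Binary.Construct.Closure.ReflexiveTransitive using (Star; ε; _◅_; _◅◅_)
import Relation.Binary.Construct.Closure.ReflexiveTransitive as Star
open import Relation.Nullary using (¬_; Dec; yes; no)
open import Relation.Nullary.Decidable using (⌊_⌋; map′; toWitness; T?; ⌊⌋-map′)

_≟V_ : ∀ {n} (u v : Vertex n) → Dec (u ≡ v)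
_≟V_ = ≡-dec Fin._≟_ Bool._≟_

inject₁≢suc : ∀ {n} (j : Fin n) → inject₁ j ≢ suc j
inject₁≢suc zero ()
inject₁≢suc (suc j) p = inject₁≢suc j (FinP.suc-injective p)

ends-injective : ∀ {n} (e e' : Edge n) → ends e ≡ ends e' → e ≡ e'
ends-injective (vert i) (vert j) p = cong vert (,-injective (proj₁ (,-injective p)) .proj₁)
ends-injective (vert i) (horiz j c d) p with ,-injective p
... | q , r = ⊥-elim (inject₁≢suc j (trans (sym (proj₁ (,-injective q))) (proj₁ (,-injective r))))
ends-injective (horiz i a b) (vert j) p with ,-injective p
... | q , r = ⊥-elim (inject₁≢suc i (trans (proj₁ (,-injective q)) (sym (proj₁ (,-injective r)))))
ends-injective (horiz i a b) (horiz j c d) p with ,-injective p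
... | q , r with ,-injective q | ,-injective r
... | _ , refl | s , refl with FinP.suc-injective s
... | refl = refl

ends-distinct : ∀ {n} (e : Edge n) → proj₁ (ends e) ≢ proj₂ (ends e)
ends-distinct (vert i) ()
ends-distinct (horiz i a b) p = inject₁≢suc i (proj₁ (,-injective p))

ends-not-reversed : ∀ {n} (e e' : Edge n) → ends e ≡ (proj₂ (ends e') , proj₁ (ends e')) → ⊥
ends-not-reversed (vert i) (vert j) p with ,-injective (proj₁ (,-injective p))
... | _ , ()
ends-not-reversed (vert i) (horiz j c d) p with ,-injective p
... | q , r = inject₁≢suc j (trans (sym (proj₁ (,-injective r))) (proj₁ (,-injective q)))
ends-not-reversed (horiz i a b) (vert j) p with ,-injective p
... | q , r = inject₁≢suc i (trans (proj₁ (,-injective q)) (sym (proj₁ (,-injective r))))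
ends-not-reversed (horiz i a b) (horiz j c d) p with ,-injective p
... | q , r = no-two-steps (toℕ i) (begin
      suc (toℕ (suc i))     ≡⟨ cong (λ k → suc (toℕ k)) (proj₁ (,-injective r)) ⟩
      suc (toℕ (inject₁ j)) ≡⟨ cong suc (FinP.toℕ-inject₁ j) ⟩
      toℕ (suc j)           ≡⟨ cong toℕ (sym (proj₁ (,-injective q))) ⟩
      toℕ (inject₁ i)       ≡⟨ FinP.toℕ-inject₁ i ⟩
      toℕ i                 ∎)
  where
  open ≡-Reasoning
  no-two-steps : ∀ k → suc (suc k) ≢ k
  no-two-steps zero ()
  no-two-steps (suc k) p = no-two-steps k (ℕP.suc-injective p)

_≟E_ : ∀ {n} (e e' : Edge n) → Dec (e ≡ e')
e ≟E e' = map′ (ends-injective e e') (cong ends) (≡-dec _≟V_ _≟V_ (ends e) (ends e'))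

Conn : ∀ {n} → EdgeSet n → Vertex n → Vertex n → Set
Conn E = Star (Adj E)

Adj-sym : ∀ {n} {E : EdgeSet n} {u v} → Adj E u v → Adj E v u
Adj-sym (e , Ee , inj₁ p) = e , Ee , inj₂ p
Adj-sym (e , Ee , inj₂ p) = e , Ee , inj₁ p

Conn-sym : ∀ {n} {E : EdgeSet n} {u v} → Conn E u v → Conn E v u
Conn-sym = Star.reverse Adj-sym

≡⇒Conn : ∀ {n} {U : EdgeSet n} {x y} → x ≡ y → Conn U x y
≡⇒Conn refl = ε

_⊆ᴱ_ : ∀ {n} → EdgeSet n → EdgeSet n → Set
E ⊆ᴱ F = ∀ e → E e ≡ true → F e ≡ true

≐⇒⊆ᴱ : ∀ {n} {E F : EdgeSet n} → E ≐ F → E ⊆ᴱ F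
≐⇒⊆ᴱ E≐F e Ee = trans (sym (E≐F e)) Ee

≐-sym : ∀ {n} {E F : EdgeSet n} → E ≐ F → F ≐ E
≐-sym E≐F e = sym (E≐F e)

Conn-mono : ∀ {n} {E F : EdgeSet n} → E ⊆ᴱ F → ∀ {u v} → Conn E u v → Conn F u v
Conn-mono E⊆F = Star.map λ (e , Ee , p) → e , E⊆F e Ee , p

Conn-closed : ∀ {n} {E : EdgeSet n} (S : Vertex n → Set) →
              (∀ {x y} → Adj E x y → S x → S y) → ∀ {u v} → Conn E u v → S u → S v
Conn-closed S closed ε Su = Su
Conn-closed S closed (a ◅ p) Su = Conn-closed S closed p (closed a Su)

_∖_ : ∀ {n} → EdgeSet n → Edge n → EdgeSet n
(E ∖ e) e' = E e' ∧ not ⌊ e' ≟E e ⌋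

∖-⊆ : ∀ {n} (E : EdgeSet n) e → (E ∖ e) ⊆ᴱ E
∖-⊆ E e e' p with E e'
... | true = refl

∖-removes : ∀ {n} (E : EdgeSet n) e e' → (E ∖ e) e' ≡ true → e' ≢ e
∖-removes E e e' p refl with e ≟E e
... | yes _ = case trans (sym (∧-zeroʳ (E e))) p of λ ()
... | no e≢e = e≢e refl

∖-keeps : ∀ {n} (E : EdgeSet n) e e' → E e' ≡ true → e' ≢ e → (E ∖ e) e' ≡ true
∖-keeps E e e' Ee' e'≢e with e' ≟E e
... | yes p = ⊥-elim (e'≢e p)
... | no _ rewrite Ee' = refl

∖-other : ∀ {n} (E : EdgeSet n) {e e'} → e' ≢ e → (E ∖ e) e' ≡ E e'
∖-other E {e} {e'} e'≢e with e' ≟E e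
... | yes p = ⊥-elim (e'≢e p)
... | no _ = ∧-identityʳ (E e')

≟E-injective : ∀ {A : Set} {n} (f : A → Edge n) → (∀ {x y} → f x ≡ f y → x ≡ y) →
               (_≟_ : (x y : A) → Dec (x ≡ y)) → ∀ x y → ⌊ f x ≟E f y ⌋ ≡ ⌊ x ≟ y ⌋
≟E-injective f f-inj _≟_ x y with f x ≟E f y | x ≟ y
... | yes _ | yes _ = refl
... | no _ | no _ = refl
... | yes p | no x≢y = ⊥-elim (x≢y (f-inj p))
... | no fx≢fy | yes p = ⊥-elim (fx≢fy (cong f p))

-- Acyclic edge sets are exactly those in which every edge is a bridge.

Bridges : ∀ {n} → EdgeSet n → Set
Bridges {n} E = ∀ (e : Edge n) → E e ≡ true → ¬ Conn (E ∖ e) (proj₁ (ends e)) (proj₂ (ends e))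

lastOr : ∀ {A : Set} → A → List A → A
lastOr d [] = d
lastOr d (x ∷ xs) = lastOr x xs

lastOr-∈ : ∀ {A : Set} (d : A) xs → lastOr d xs ∈ d ∷ xs
lastOr-∈ d [] = here refl
lastOr-∈ d (x ∷ xs) = there (lastOr-∈ x xs)

Linked-snoc : ∀ {A : Set} {R : A → A → Set} {x xs y} →
              Linked R (x ∷ xs) → R (lastOr x xs) y → Linked R ((x ∷ xs) ∷ʳ y)
Linked-snoc {xs = []} [-] r = r ∷ [-]
Linked-snoc {xs = _ ∷ _} (r ∷ rs) r' = r ∷ Linked-snoc rs r'

Linked-unsnoc : ∀ {A : Set} {R : A → A → Set} {x} xs {y} →
                Linked R ((x ∷ xs) ∷ʳ y) → Linked R (x ∷ xs) × R (lastOr x xs) y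
Linked-unsnoc [] (r ∷ [-]) = [-] , r
Linked-unsnoc (_ ∷ zs) (r ∷ rs) with Linked-unsnoc zs rs
... | rs' , r' = r ∷ rs' , r'

record SimplePath {n} (E : EdgeSet n) (u v : Vertex n) : Set where
  field
    ys     : List (Vertex n)
    linked : Linked (Adj E) (u ∷ ys)
    unique : Unique (u ∷ ys)
    last   : lastOr u ys ≡ v

suffix : ∀ {n} {E : EdgeSet n} {u x : Vertex n} xs → u ∈ x ∷ xs →
         Linked (Adj E) (x ∷ xs) → Unique (x ∷ xs) → SimplePath E u (lastOr x xs)
suffix xs (here refl) lk un = record { ys = xs ; linked = lk ; unique = un ; last = refl }
suffix (_ ∷ xs) (there u∈) lk (_ ∷ un) = suffix xs u∈ (Linked.tail lk) un

simplify : ∀ {n} {E : EdgeSet n} {u v} → Conn E u v → SimplePath E u v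
simplify ε = record { ys = [] ; linked = [-] ; unique = [] ∷ [] ; last = refl }
simplify {u = u} (_◅_ {j = w} a p) with simplify p
... | record { ys = ys ; linked = lk ; unique = un ; last = la } with member? _≟V_ u (w ∷ ys)
...   | yes u∈ = let s = suffix ys u∈ lk un in
                 record { ys = SimplePath.ys s ; linked = SimplePath.linked s
                        ; unique = SimplePath.unique s ; last = trans (SimplePath.last s) la }
...   | no u∉ = record { ys = w ∷ ys ; linked = a ∷ lk ; unique = AllP.¬Any⇒All¬ (w ∷ ys) u∉ ∷ un ; last = la }

-- an edge that is not a bridge closes a cycle
acyclic⇒bridges : ∀ {n} {E : EdgeSet n} → Acyclic E → Bridges E
acyclic⇒bridges {E = E} acyc e Ee p = go refl p
  where
  go : ∀ {a b} → ends e ≡ (a , b) → Conn (E ∖ e) a b → ⊥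
  go e≡ab p with simplify p
  ... | record { ys = [] ; last = refl } = ends-distinct e (trans (cong proj₁ e≡ab) (sym (cong proj₂ e≡ab)))
  ... | record { ys = _ ∷ [] ; linked = (e' , E∖e' , inj₁ q) ∷ [-] ; last = refl } =
        ∖-removes E e e' E∖e' (ends-injective e' e (trans q (sym e≡ab)))
  ... | record { ys = _ ∷ [] ; linked = (e' , _ , inj₂ q) ∷ [-] ; last = refl } =
        ends-not-reversed e' e (trans q (cong (λ (x , y) → y , x) (sym e≡ab)))
  ... | record { ys = y ∷ z ∷ zs ; linked = lk ; unique = un ; last = la } =
        acyc (_ ∷ y ∷ z ∷ zs) (s≤s (s≤s (s≤s z≤n)) , un ,
          Linked-snoc (Linked.map (λ (e' , E∖e' , q) → e' , ∖-⊆ E e e' E∖e' , q) lk)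
                      (subst (λ w → Adj E w _) (sym la) (e , Ee , inj₂ e≡ab)))

joins-unique : ∀ {n} {e : Edge n} {p q p' q'} →
               (ends e ≡ (p , q) ⊎ ends e ≡ (q , p)) → (ends e ≡ (p' , q') ⊎ ends e ≡ (q' , p')) →
               (p ≡ p' × q ≡ q') ⊎ (p ≡ q' × q ≡ p')
joins-unique (inj₁ r) (inj₁ r') = inj₁ (,-injective (trans (sym r) r'))
joins-unique (inj₁ r) (inj₂ r') = inj₂ (,-injective (trans (sym r) r'))
joins-unique (inj₂ r) (inj₁ r') with ,-injective (trans (sym r) r')
... | q≡p' , p≡q' = inj₂ (p≡q' , q≡p')
joins-unique (inj₂ r) (inj₂ r') with ,-injective (trans (sym r) r')
... | q≡q' , p≡p' = inj₁ (p≡p' , q≡q')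

-- on a cycle, the closing edge is not a bridge: the rest of the cycle avoids it
bridges⇒acyclic : ∀ {n} {E : EdgeSet n} → Bridges E → Acyclic E
bridges⇒acyclic br [] ()
bridges⇒acyclic br (v ∷ []) (s≤s () , _)
bridges⇒acyclic br (v ∷ w ∷ []) (s≤s (s≤s ()) , _)
bridges⇒acyclic {E = E} br (v ∷ w ∷ x ∷ xs) (_ , (v∉ ∷ w∉ ∷ _) , lk)
  with Linked-unsnoc (w ∷ x ∷ xs) lk
... | (e₀ , Ee₀ , vw) ∷ lk' , (e , Ee , lv) = br e Ee (ends-connected lv)
  where
  l∈ : lastOr x xs ∈ x ∷ xs
  l∈ = lastOr-∈ x xs
  walk : ∀ {y} ys → Linked (Adj E) (y ∷ ys) → All (v ≢_) (y ∷ ys) → Conn (E ∖ e) y (lastOr y ys)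
  walk [] [-] _ = ε
  walk (z ∷ zs) ((e' , Ee' , yz) ∷ lk) (v≢y ∷ v≢z ∷ v∉zs) =
    (e' , ∖-keeps E e e' Ee' e'≢e , yz) ◅ walk zs lk (v≢z ∷ v∉zs)
    where
    e'≢e : e' ≢ e
    e'≢e refl with joins-unique yz lv
    ... | inj₁ (_ , z≡v) = v≢z (sym z≡v)
    ... | inj₂ (y≡v , _) = v≢y (sym y≡v)
  e₀≢e : e₀ ≢ e
  e₀≢e refl with joins-unique vw lv
  ... | inj₁ (v≡l , _) = AllP.All¬⇒¬Any v∉ (there (subst (_∈ x ∷ xs) (sym v≡l) l∈))
  ... | inj₂ (_ , w≡l) = AllP.All¬⇒¬Any w∉ (subst (_∈ x ∷ xs) (sym w≡l) l∈)
  cycle-rest : Conn (E ∖ e) v (lastOr x xs)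
  cycle-rest = (e₀ , ∖-keeps E e e₀ Ee₀ e₀≢e , vw) ◅ walk (x ∷ xs) lk' v∉
  ends-connected : (ends e ≡ (lastOr x xs , v) ⊎ ends e ≡ (v , lastOr x xs)) →
                   Conn (E ∖ e) (proj₁ (ends e)) (proj₂ (ends e))
  ends-connected (inj₁ p) = subst₂ (Conn (E ∖ e)) (sym (cong proj₁ p)) (sym (cong proj₂ p)) (Conn-sym cycle-rest)
  ends-connected (inj₂ p) = subst₂ (Conn (E ∖ e)) (sym (cong proj₁ p)) (sym (cong proj₂ p)) cycle-rest

PresentIn : ∀ {n} → Subset (suc n) → EdgeSet n → Set
PresentIn {n} D E = ∀ (e : Edge n) → E e ≡ true → present D e ≡ true

Tree : ∀ {n} → Subset (suc n) → EdgeSet n → Set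
Tree D E = PresentIn D E × Connected E × Bridges E

SpanningTree⇒Tree : ∀ {n} {D} {E : EdgeSet n} → SpanningTree D E → Tree D E
SpanningTree⇒Tree (pres , conn , acyc) = pres , conn , acyclic⇒bridges acyc

Tree⇒SpanningTree : ∀ {n} {D} {E : EdgeSet n} → Tree D E → SpanningTree D E
Tree⇒SpanningTree (pres , conn , br) = pres , conn , bridges⇒acyclic br

∖-resp : ∀ {n} {E F : EdgeSet n} → E ≐ F → ∀ e → (E ∖ e) ≐ (F ∖ e)
∖-resp E≐F e e' = cong (_∧ _) (E≐F e')

Tree-resp : ∀ {n} {D} {E F : EdgeSet n} → E ≐ F → Tree D E → Tree D F
Tree-resp E≐F (pres , conn , br) =
  (λ e Fe → pres e (trans (E≐F e) Fe)) ,
  (λ u v → Conn-mono (≐⇒⊆ᴱ E≐F) (conn u v)) ,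
  (λ e Fe c → br e (trans (E≐F e) Fe) (Conn-mono (≐⇒⊆ᴱ (≐-sym (∖-resp E≐F e))) c))

-- G_{m+1} is column 0 glued to a shifted copy of G_m.

sh : ∀ {m} → Vertex m → Vertex (suc m)
sh (i , a) = suc i , a

shE : ∀ {m} → Edge m → Edge (suc m)
shE (vert i) = vert (suc i)
shE (horiz i a b) = horiz (suc i) a b

ends-shE : ∀ {m} (e : Edge m) → ends (shE e) ≡ (sh (proj₁ (ends e)) , sh (proj₂ (ends e)))
ends-shE (vert i) = refl
ends-shE (horiz i a b) = refl

shE-injective : ∀ {m} {e e' : Edge m} → shE e ≡ shE e' → e ≡ e'
shE-injective {e = vert i} {vert j} refl = refl
shE-injective {e = horiz i a b} {horiz j c d} refl = refl

j₀ j₁ : ∀ {m} → Vertex m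
j₀ = zero , false
j₁ = zero , true

h₀ h₁ : ∀ {m} → Vertex (suc m)
h₀ = suc zero , false
h₁ = suc zero , true

-- the five edges meeting column 0: the rung (vertical edge) and the four
-- links from (0 , a) to (1 , b)
data Slot : Set where
  rung : Slot
  link : Bool → Bool → Slot

slotEdge : ∀ {m} → Slot → Edge (suc m)
slotEdge rung = vert zero
slotEdge (link a b) = horiz zero a b

slotEdge-injective : ∀ {m} {σ τ : Slot} → slotEdge {m} σ ≡ slotEdge τ → σ ≡ τ
slotEdge-injective {σ = rung} {rung} refl = refl
slotEdge-injective {σ = link a b} {link c d} refl = refl

_≟S_ : (σ τ : Slot) → Dec (σ ≡ τ)
σ ≟S τ with slotEdge {0} σ ≟E slotEdge τ
... | yes p = yes (slotEdge-injective p)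
... | no σ≢τ = no λ p → σ≢τ (cong slotEdge p)

shE≢slotEdge : ∀ {m} (e : Edge m) σ → shE e ≢ slotEdge σ
shE≢slotEdge (vert i) rung ()
shE≢slotEdge (horiz i a b) (link c d) ()

-- a choice of edges in column 0
Loc : Set
Loc = Bool × Bool × Bool × Bool × Bool

entry : Loc → Slot → Bool
entry (v , _) rung = v
entry (_ , ff , ft , tf , tt) (link false false) = ff
entry (_ , ff , ft , tf , tt) (link false true) = ft
entry (_ , ff , ft , tf , tt) (link true false) = tf
entry (_ , ff , ft , tf , tt) (link true true) = tt

fromEntries : (Slot → Bool) → Loc
fromEntries f = f rung , f (link false false) , f (link false true) , f (link true false) , f (link true true)

entry-fromEntries : ∀ f σ → entry (fromEntries f) σ ≡ f σ
entry-fromEntries f rung = refl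
entry-fromEntries f (link false false) = refl
entry-fromEntries f (link false true) = refl
entry-fromEntries f (link true false) = refl
entry-fromEntries f (link true true) = refl

combine : ∀ {m} → Loc → EdgeSet m → EdgeSet (suc m)
combine L t (vert zero) = entry L rung
combine L t (vert (suc i)) = t (vert i)
combine L t (horiz zero a b) = entry L (link a b)
combine L t (horiz (suc i) a b) = t (horiz i a b)

column₀ : ∀ {m} → EdgeSet (suc m) → Loc
column₀ E = fromEntries (λ σ → E (slotEdge σ))

rest : ∀ {m} → EdgeSet (suc m) → EdgeSet m
rest E e = E (shE e)

decompose : ∀ {m} (E : EdgeSet (suc m)) → E ≐ combine (column₀ E) (rest E)
decompose E (vert zero) = refl
decompose E (vert (suc i)) = refl
decompose E (horiz zero a b) = sym (entry-fromEntries (λ σ → E (slotEdge σ)) (link a b))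
decompose E (horiz (suc i) a b) = refl

combine-shE : ∀ {m} L (t : EdgeSet m) e → combine L t (shE e) ≡ t e
combine-shE L t (vert i) = refl
combine-shE L t (horiz i a b) = refl

column₀-combine : ∀ {m} L (t : EdgeSet m) → column₀ (combine L t) ≡ L
column₀-combine (v , ff , ft , tf , tt) t = refl

rest-combine : ∀ {m} L (t : EdgeSet m) → rest (combine L t) ≐ t
rest-combine L t = combine-shE L t

combine-resp : ∀ {m} L {t u : EdgeSet m} → t ≐ u → combine L t ≐ combine L u
combine-resp L t≐u (vert zero) = refl
combine-resp L t≐u (vert (suc i)) = t≐u (vert i)
combine-resp L t≐u (horiz zero a b) = refl
combine-resp L t≐u (horiz (suc i) a b) = t≐u (horiz i a b)

combine-⊇ : ∀ {m} L (t : EdgeSet m) e → t e ≡ true → combine L t (shE e) ≡ true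
combine-⊇ L t e te = trans (combine-shE L t e) te

present-shift : ∀ {m} d (D : Subset (suc m)) e → present (d ∷ D) (shE e) ≡ present D e
present-shift d D (vert i) = refl
present-shift d D (horiz i a b) = refl

lift : ∀ {m} {t : EdgeSet m} {W : EdgeSet (suc m)} → (∀ e → t e ≡ true → W (shE e) ≡ true) →
       ∀ {x y} → Conn t x y → Conn W (sh x) (sh y)
lift t⊆W = Star.gmap sh λ (e , te , p) → shE e , t⊆W e te , shift-ends p
  where
  shift-ends : ∀ {e x y} → (ends e ≡ (x , y) ⊎ ends e ≡ (y , x)) →
               ends (shE e) ≡ (sh x , sh y) ⊎ ends (shE e) ≡ (sh y , sh x)
  shift-ends {e} (inj₁ refl) = inj₁ (ends-shE e)
  shift-ends {e} (inj₂ refl) = inj₂ (ends-shE e)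

-- deleting a column-0 edge only changes the column-0 part
clear : Slot → Loc → Loc
clear σ L = fromEntries (λ τ → entry L τ ∧ not ⌊ τ ≟S σ ⌋)

combine-slot : ∀ {m} L (t : EdgeSet m) σ → combine L t (slotEdge σ) ≡ entry L σ
combine-slot L t rung = refl
combine-slot L t (link a b) = refl

remove-slot-at : ∀ {m} σ L (t : EdgeSet m) τ →
                 (combine L t ∖ slotEdge σ) (slotEdge τ) ≡ combine (clear σ L) t (slotEdge τ)
remove-slot-at σ L t τ = begin
  combine L t (slotEdge τ) ∧ not ⌊ slotEdge τ ≟E slotEdge σ ⌋
    ≡⟨ cong₂ (λ x y → x ∧ not y) (combine-slot L t τ) (≟E-injective slotEdge slotEdge-injective _≟S_ τ σ) ⟩
  entry L τ ∧ not ⌊ τ ≟S σ ⌋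
    ≡⟨ sym (entry-fromEntries (λ τ → entry L τ ∧ not ⌊ τ ≟S σ ⌋) τ) ⟩
  entry (clear σ L) τ
    ≡⟨ sym (combine-slot (clear σ L) t τ) ⟩
  combine (clear σ L) t (slotEdge τ) ∎
  where open ≡-Reasoning

remove-slot : ∀ {m} σ L (t : EdgeSet m) → (combine L t ∖ slotEdge σ) ≐ combine (clear σ L) t
remove-slot σ L t (vert zero) = remove-slot-at σ L t rung
remove-slot σ L t (vert (suc i)) = ∖-other (combine L t) (shE≢slotEdge (vert i) σ)
remove-slot σ L t (horiz zero a b) = remove-slot-at σ L t (link a b)
remove-slot σ L t (horiz (suc i) a b) = ∖-other (combine L t) (shE≢slotEdge (horiz i a b) σ)

-- Finite enumerations; a Boolean property that holds on an exhaustive list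
-- holds everywhere, so finitely many cases can be decided by evaluation.

bools : List Bool
bools = false ∷ true ∷ []

∈-bools : ∀ b → b ∈ bools
∈-bools false = here refl
∈-bools true = there (here refl)

allLocs : List Loc
allLocs = cartesianProduct bools (cartesianProduct bools (cartesianProduct bools (cartesianProduct bools bools)))

∈-allLocs : ∀ L → L ∈ allLocs
∈-allLocs (v , ff , ft , tf , tt) =
  ∈-cartesianProduct⁺ (∈-bools v) (∈-cartesianProduct⁺ (∈-bools ff)
    (∈-cartesianProduct⁺ (∈-bools ft) (∈-cartesianProduct⁺ (∈-bools tf) (∈-bools tt))))

unique-allLocs : Unique allLocs
unique-allLocs = cartesianProduct⁺ u (cartesianProduct⁺ u (cartesianProduct⁺ u (cartesianProduct⁺ u u)))
  where
  u : Unique bools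
  u = ((λ ()) ∷ []) ∷ [] ∷ []

vertices₁ : List (Vertex 1)
vertices₁ = cartesianProduct (allFin 2) bools

∈-vertices₁ : ∀ x → x ∈ vertices₁
∈-vertices₁ (i , a) = ∈-cartesianProduct⁺ (∈-allFin i) (∈-bools a)

slots : List Slot
slots = rung ∷ link false false ∷ link false true ∷ link true false ∷ link true true ∷ []

∈-slots : ∀ σ → σ ∈ slots
∈-slots rung = here refl
∈-slots (link false false) = there (here refl)
∈-slots (link false true) = there (there (here refl))
∈-slots (link true false) = there (there (there (here refl)))
∈-slots (link true true) = there (there (there (there (here refl))))

all-at : ∀ {A : Set} {xs : List A} (p : A → Bool) → T (all p xs) → ∀ {x} → x ∈ xs → T (p x)
all-at {xs = xs} p holds = All.lookup (AllP.all⁺ p xs holds)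

everywhere : ∀ {A : Set} {xs : List A} → (∀ x → x ∈ xs) → (p : A → Bool) → T (all p xs) → ∀ x → T (p x)
everywhere complete p holds x = all-at p holds (complete x)

witness : ∀ {A : Set} {xs : List A} (p : A → Bool) → T (any p xs) → Σ A (T ∘ p)
witness {xs = xs} p holds = Any.satisfied (AnyP.any⁻ p xs holds)

T⇒≡ : ∀ {b} → T b → b ≡ true
T⇒≡ = Equivalence.to T-≡

≡⇒T : ∀ {b} → b ≡ true → T b
≡⇒T = Equivalence.from T-≡

T-∧-split : ∀ {a b} → T (a ∧ b) → T a × T b
T-∧-split = Equivalence.to T-∧

T-∨-split : ∀ {a b} → T (a ∨ b) → T a ⊎ T b
T-∨-split = Equivalence.to T-∨

T-not : ∀ {b} → T b → T (not b) → ⊥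
T-not {true} _ ()

T-∧-join : ∀ {a b} → T a → T b → T (a ∧ b)
T-∧-join x y = Equivalence.from T-∧ (x , y)

refute : ∀ b → (T b → ⊥) → T (not b)
refute false _ = _
refute true ¬b = ¬b _

implies : ∀ a {b} → T (not a ∨ b) → T a → T b
implies true b _ = b

-- Column 0 of G_{m+1} together with column 1 is a copy of
-- G_1; the rest of the graph is summarised by a single Boolean s, which
-- stands for the column-1 rung of G_1 ("the two vertices of column 1 are
-- joined through the rest").

local : Loc → Bool → EdgeSet 1
local L s = combine L (λ _ → s)

emb : ∀ {m} → Vertex 1 → Vertex (suc m)
emb (zero , a) = zero , a
emb (suc zero , a) = suc zero , a

-- bounded search for a path in a subgraph of G_1 (4 vertices, so 3 steps suffice):
-- reachIn k U x y tests for a walk of length at most k from x to y;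
-- via k U x y e tests for one that starts along the edge e
mutual
  reachIn : ℕ → EdgeSet 1 → Vertex 1 → Vertex 1 → Bool
  reachIn zero U x y = ⌊ x ≟V y ⌋
  reachIn (suc k) U x y = ⌊ x ≟V y ⌋ ∨ any (via k U x y) (allEdges 1)

  via : ℕ → EdgeSet 1 → Vertex 1 → Vertex 1 → Edge 1 → Bool
  via k U x y e = U e ∧ ((⌊ x ≟V proj₁ (ends e) ⌋ ∧ reachIn k U (proj₂ (ends e)) y)
                      ∨ (⌊ x ≟V proj₂ (ends e) ⌋ ∧ reachIn k U (proj₁ (ends e)) y))

reach : EdgeSet 1 → Vertex 1 → Vertex 1 → Bool
reach = reachIn 3

mutual
  reachIn-sound : ∀ k {U x y} → T (reachIn k U x y) → Conn U x y
  reachIn-sound zero {x = x} {y} r = ≡⇒Conn (toWitness {a? = x ≟V y} r)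
  reachIn-sound (suc k) {U} {x} {y} r with T-∨-split {⌊ x ≟V y ⌋} {any (via k U x y) (allEdges 1)} r
  ... | inj₁ same = ≡⇒Conn (toWitness {a? = x ≟V y} same)
  ... | inj₂ found with witness {xs = allEdges 1} (via k U x y) found
  ...   | e , through = via-sound k e through

  via-sound : ∀ k {U x y} e → T (via k U x y e) → Conn U x y
  via-sound k {U} {x} {y} e v with T-∧-split {U e} v
  ... | Ue , way with T-∨-split {⌊ x ≟V proj₁ (ends e) ⌋ ∧ reachIn k U (proj₂ (ends e)) y} way
  ...   | inj₁ fwd with T-∧-split {⌊ x ≟V proj₁ (ends e) ⌋} fwd
  ...     | start , r = subst (λ z → Conn U z y) (sym (toWitness {a? = x ≟V proj₁ (ends e)} start))
                              ((e , T⇒≡ Ue , inj₁ refl) ◅ reachIn-sound k r)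
  via-sound k {U} {x} {y} e v | Ue , way | inj₂ bwd with T-∧-split {⌊ x ≟V proj₂ (ends e) ⌋} bwd
  ...     | start , r = subst (λ z → Conn U z y) (sym (toWitness {a? = x ≟V proj₂ (ends e)} start))
                              ((e , T⇒≡ Ue , inj₂ refl) ◅ reachIn-sound k r)

reach-sound : ∀ {U x y} → T (reach U x y) → Conn U x y
reach-sound = reachIn-sound 3

Cut : Set
Cut = Bool × Bool × Bool × Bool

_∋_ : Cut → Vertex 1 → Bool
(c₀ , _) ∋ (zero , false) = c₀
(_ , c₁ , _) ∋ (zero , true) = c₁
(_ , _ , d₀ , _) ∋ (suc zero , false) = d₀
(_ , _ , _ , d₁) ∋ (suc zero , true) = d₁

allCuts : List Cut
allCuts = cartesianProduct bools (cartesianProduct bools (cartesianProduct bools bools))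

∈-allEdges₁ : ∀ e → e ∈ allEdges 1
∈-allEdges₁ (vert zero) = here refl
∈-allEdges₁ (vert (suc zero)) = there (here refl)
∈-allEdges₁ (horiz zero false false) = there (there (here refl))
∈-allEdges₁ (horiz zero false true) = there (there (there (here refl)))
∈-allEdges₁ (horiz zero true false) = there (there (there (there (here refl))))
∈-allEdges₁ (horiz zero true true) = there (there (there (there (there (here refl)))))

respects : EdgeSet 1 → Cut → Edge 1 → Bool
respects U S e = not (U e) ∨ ⌊ S ∋ proj₁ (ends e) Bool.≟ S ∋ proj₂ (ends e) ⌋

closed : EdgeSet 1 → Cut → Bool
closed U S = all (respects U S) (allEdges 1)

separates : EdgeSet 1 → Vertex 1 → Vertex 1 → Bool
separates U x y = any (λ S → closed U S ∧ S ∋ x ∧ not (S ∋ y)) allCuts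

closed-sound : ∀ {U S} → T (closed U S) → ∀ e → U e ≡ true → S ∋ proj₁ (ends e) ≡ S ∋ proj₂ (ends e)
closed-sound {U} {S} cl e Ue with T-∨-split {not (U e)} (all-at (respects U S) cl (∈-allEdges₁ e))
... | inj₁ notUe rewrite Ue = ⊥-elim notUe
... | inj₂ same = toWitness same

-- Transfer between the local graph and combine L t. Write
-- "s reflects t" when s is true iff t joins (0,F) and (0,T); each
-- direction of transfer needs one half of this.

local-path : ∀ {m} L s {t : EdgeSet m} → (T s → Conn t j₀ j₁) →
             ∀ {x y} → Conn (local L s) x y → Conn (combine L t) (emb x) (emb y)
local-path L s {t} joined = Star.concat ∘ Star.gmap emb step
  where
  forward : ∀ e → local L s e ≡ true → Conn (combine L t) (emb (proj₁ (ends e))) (emb (proj₂ (ends e)))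
  forward (vert zero) Ue = (vert zero , Ue , inj₁ refl) ◅ ε
  forward (vert (suc zero)) Ue = lift (combine-⊇ L t) (joined (≡⇒T Ue))
  forward (horiz zero a b) Ue = (horiz zero a b , Ue , inj₁ refl) ◅ ε
  step : ∀ {x y} → Adj (local L s) x y → Conn (combine L t) (emb x) (emb y)
  step (e , Ue , inj₁ refl) = forward e Ue
  step (e , Ue , inj₂ refl) = Conn-sym (forward e Ue)

-- Lifting a closed vertex set S of the local graph to combine L t: a vertex
-- of column 0 is in the lift iff it is in S, a vertex further right iff its
-- component in t contains a column-1 vertex of S. When s reflects that t
-- does not join (0,F) and (0,T), the lift is again closed.
module CutLift {m} (L : Loc) (s : Bool) (t : EdgeSet m) (S : Cut)
               (S-closed : T (closed (local L s) S)) (apart : T (not s) → ¬ Conn t j₀ j₁) where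

  Lift : Vertex (suc m) → Set
  Lift (zero , a) = T (S ∋ (zero , a))
  Lift (suc i , a) = Σ Bool λ b → T (S ∋ (suc zero , b)) × Conn t (zero , b) (i , a)

  respected : ∀ e → local L s e ≡ true → S ∋ proj₁ (ends e) ≡ S ∋ proj₂ (ends e)
  respected = closed-sound {local L s} {S} S-closed

  -- column-1 vertices joined in t are on the same side of S: either s holds
  -- and S respects the column-1 rung, or t does not join them at all
  joined-rung : ∀ s' → s ≡ s' → Conn t j₀ j₁ → S ∋ (suc zero , false) ≡ S ∋ (suc zero , true)
  joined-rung false s≡ p = ⊥-elim (apart (subst (T ∘ not) (sym s≡) _) p)
  joined-rung true s≡ p = respected (vert (suc zero)) s≡

  agree : ∀ b b' → Conn t (zero , b) (zero , b') → S ∋ (suc zero , b) ≡ S ∋ (suc zero , b')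
  agree false false p = refl
  agree true true p = refl
  agree false true p = joined-rung s refl p
  agree true false p = sym (joined-rung s refl (Conn-sym p))

  forward : ∀ e → combine L t e ≡ true → Lift (proj₁ (ends e)) → Lift (proj₂ (ends e))
  forward (vert zero) We = subst T (respected (vert zero) We)
  forward (vert (suc i)) We (b , Sb , p) = b , Sb , p ◅◅ (vert i , We , inj₁ refl) ◅ ε
  forward (horiz zero a b) We Sa = b , subst T (respected (horiz zero a b) We) Sa , ε
  forward (horiz (suc i) a c) We (b , Sb , p) = b , Sb , p ◅◅ (horiz i a c , We , inj₁ refl) ◅ ε

  backward : ∀ e → combine L t e ≡ true → Lift (proj₂ (ends e)) → Lift (proj₁ (ends e))
  backward (vert zero) We = subst T (sym (respected (vert zero) We))
  backward (vert (suc i)) We (b , Sb , p) = b , Sb , p ◅◅ (vert i , We , inj₂ refl) ◅ ε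
  backward (horiz zero a b) We (b' , Sb' , p) =
    subst T (sym (trans (respected (horiz zero a b) We) (sym (agree b' b p)))) Sb'
  backward (horiz (suc i) a c) We (b , Sb , p) = b , Sb , p ◅◅ (horiz i a c , We , inj₂ refl) ◅ ε

  Lift-closed : ∀ {u v} → Adj (combine L t) u v → Lift u → Lift v
  Lift-closed (e , We , inj₁ refl) = forward e We
  Lift-closed (e , We , inj₂ refl) = backward e We

  inside : ∀ x → T (S ∋ x) → Lift (emb x)
  inside (zero , a) x∈ = x∈
  inside (suc zero , b) x∈ = b , x∈ , ε

  outside : ∀ y → T (not (S ∋ y)) → ¬ Lift (emb y)
  outside (zero , a) y∉ y∈ = T-not y∈ y∉
  outside (suc zero , b) y∉ (b' , Sb' , p) = T-not (subst T (agree b' b p) Sb') y∉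

local-cut : ∀ {m} L s {t : EdgeSet m} → (T (not s) → ¬ Conn t j₀ j₁) →
            ∀ {x y} → T (separates (local L s) x y) → ¬ Conn (combine L t) (emb x) (emb y)
local-cut L s {t} apart {x} {y} sep path
  with witness {xs = allCuts} (λ S → closed (local L s) S ∧ S ∋ x ∧ not (S ∋ y)) sep
... | S , certificate with T-∧-split {closed (local L s) S} certificate
...   | S-closed , x∈y∉ with T-∧-split {S ∋ x} x∈y∉
...     | x∈ , y∉ = outside y y∉ (Conn-closed Lift Lift-closed path (inside x x∈))
  where open CutLift L s t S S-closed apart

end₁ end₂ : Slot → Vertex 1
end₁ σ = proj₁ (ends (slotEdge σ))
end₂ σ = proj₂ (ends (slotEdge σ))

spans : EdgeSet 1 → Bool
spans U = all (λ x → reach U x (suc zero , false)) vertices₁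

allBridges : Loc → Bool → Bool
allBridges L s = all (λ σ → not (entry L σ) ∨ separates (local (clear σ L) s) (end₁ σ) (end₂ σ)) slots

fits : Loc → Bool → Bool
fits L s = spans (local L s) ∧ allBridges L s

-- certificates that L does not: a vertex cut off from (1,F), or a
-- column-0 edge lying on a cycle
disconnects closesCycle : Loc → Bool → Bool
disconnects L s = any (λ x → separates (local L s) x (suc zero , false)) vertices₁
closesCycle L s = any (λ σ → entry L σ ∧ reach (local (clear σ L) s) (end₁ σ) (end₂ σ)) slots

joins : Loc → Bool
joins L = reach (local L false) (suc zero , false) (suc zero , true)

-- the vertex of column 1 (true: (1,T)) to which (0 , a) is attached through column 0
side : Loc → Bool → Bool
side L a = reach (local L false) (zero , a) (suc zero , true)

at-every : ∀ {A : Set} {xs : List A} → (∀ x → x ∈ xs) → (p : Loc → A → Bool) →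
           T (all (λ L → all (p L) xs) allLocs) → ∀ L x → T (p L x)
at-every {xs = xs} complete p holds L x = all-at (p L) (everywhere ∈-allLocs (λ L → all (p L) xs) holds L) (complete x)

∈-pairs : ∀ ab → ab ∈ cartesianProduct bools bools
∈-pairs (a , b) = ∈-cartesianProduct⁺ (∈-bools a) (∈-bools b)

fits-or-obstructed : ∀ L s → T (fits L s ∨ (disconnects L s ∨ closesCycle L s))
fits-or-obstructed = at-every ∈-bools (λ L s → fits L s ∨ (disconnects L s ∨ closesCycle L s)) _

joins⇒cycle : ∀ L → T (joins L) → T (closesCycle L true)
joins⇒cycle L = implies (joins L) (everywhere ∈-allLocs (λ L → not (joins L) ∨ closesCycle L true) _ L)

fits-joined : ∀ L → T (fits L true) → T (not (joins L))
fits-joined L = implies (fits L true) (everywhere ∈-allLocs (λ L → not (fits L true) ∨ not (joins L)) _ L)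

fits-apart : ∀ L → T (fits L false) → T (joins L)
fits-apart L = implies (fits L false) (everywhere ∈-allLocs (λ L → not (fits L false) ∨ joins L) _ L)

side-link : ∀ L a b → T (entry L (link a b)) → T (⌊ side L a Bool.≟ b ⌋ ∨ joins L)
side-link L a b = implies (entry L (link a b))
  (at-every ∈-pairs (λ L (a , b) → not (entry L (link a b)) ∨ (⌊ side L a Bool.≟ b ⌋ ∨ joins L)) _ L (a , b))

side-rung : ∀ L → T (entry L rung) → T (⌊ side L false Bool.≟ side L true ⌋ ∨ joins L)
side-rung L = implies (entry L rung)
  (everywhere ∈-allLocs (λ L → not (entry L rung) ∨ (⌊ side L false Bool.≟ side L true ⌋ ∨ joins L)) _ L)

addRung : ∀ {m} → Bool → EdgeSet m → EdgeSet m
addRung b t (vert zero) = b ∨ t (vert zero)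
addRung b t (vert (suc i)) = t (vert (suc i))
addRung b t (horiz i a c) = t (horiz i a c)

⊆addRung : ∀ {m} b (t : EdgeSet m) → t ⊆ᴱ addRung b t
⊆addRung true t (vert zero) _ = refl
⊆addRung false t (vert zero) te = te
⊆addRung b t (vert (suc i)) te = te
⊆addRung b t (horiz i a c) te = te

addRung-false : ∀ {m} (t : EdgeSet m) → addRung false t ⊆ᴱ t
addRung-false t (vert zero) te = te
addRung-false t (vert (suc i)) te = te
addRung-false t (horiz i a c) te = te

-- collapse column 0 onto column 1 along the attachments of column 0
π : ∀ {m} → Loc → Vertex (suc m) → Vertex m
π L (zero , a) = zero , side L a
π L (suc i , a) = i , a

project : ∀ {m} {L} {t : EdgeSet m} {u v} → Conn (combine L t) u v → Conn (addRung (joins L) t) (π L u) (π L v)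
project {L = L} {t} = Star.concat ∘ Star.gmap (π L) step
  where
  rung-path : ∀ a a' → Conn (addRung true t) (zero , a) (zero , a')
  rung-path false false = ε
  rung-path true true = ε
  rung-path false true = (vert zero , refl , inj₁ refl) ◅ ε
  rung-path true false = (vert zero , refl , inj₂ refl) ◅ ε
  hop : ∀ a a' → T (⌊ a Bool.≟ a' ⌋ ∨ joins L) → Conn (addRung (joins L) t) (zero , a) (zero , a')
  hop a a' h with T-∨-split {⌊ a Bool.≟ a' ⌋} h
  ... | inj₁ same = ≡⇒Conn (cong (zero ,_) (toWitness same))
  ... | inj₂ j = subst (λ b → Conn (addRung b t) _ _) (sym (T⇒≡ j)) (rung-path a a')
  forward : ∀ e → combine L t e ≡ true → Conn (addRung (joins L) t) (π L (proj₁ (ends e))) (π L (proj₂ (ends e)))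
  forward (vert zero) We = hop _ _ (side-rung L (≡⇒T We))
  forward (vert (suc i)) We = (vert i , ⊆addRung (joins L) t (vert i) We , inj₁ refl) ◅ ε
  forward (horiz zero a b) We = hop _ _ (side-link L a b (≡⇒T We))
  forward (horiz (suc i) a b) We = (horiz i a b , We , inj₁ refl) ◅ ε
  step : ∀ {u v} → Adj (combine L t) u v → Conn (addRung (joins L) t) (π L u) (π L v)
  step (e , We , inj₁ refl) = forward e We
  step (e , We , inj₂ refl) = Conn-sym (forward e We)

-- t is a spanning forest of G^D with two trees, separating the ends of the
-- first rung: that rung is not in t, and adding it yields a spanning tree
SplitForest : ∀ {m} → Subset (suc m) → EdgeSet m → Set
SplitForest (_ ∷ D) t = t (vert zero) ≡ false × Tree (false ∷ D) (addRung true t)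

combine-∖ : ∀ {m} L (t : EdgeSet m) e → combine L (t ∖ e) ≐ (combine L t ∖ shE e)
combine-∖ L t e (vert zero) = sym (∖-other (combine L t) (λ p → shE≢slotEdge e rung (sym p)))
combine-∖ L t e (vert (suc i)) =
  sym (cong (λ b → t (vert i) ∧ not b) (≟E-injective shE shE-injective _≟E_ (vert i) e))
combine-∖ L t e (horiz zero a b) = sym (∖-other (combine L t) (λ p → shE≢slotEdge e (link a b) (sym p)))
combine-∖ L t e (horiz (suc i) a b) =
  sym (cong (λ c → t (horiz i a b) ∧ not c) (≟E-injective shE shE-injective _≟E_ (horiz i a b) e))

shifted-bridge : ∀ {m} {L} {t : EdgeSet m} e → Bridges (combine L t) → t e ≡ true →
                 ¬ Conn (combine L (t ∖ e)) (sh (proj₁ (ends e))) (sh (proj₂ (ends e)))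
shifted-bridge {L = L} {t} e br te c =
  br (shE e) (combine-⊇ L t e te)
     (subst₂ (Conn (combine L t ∖ shE e)) (sym (cong proj₁ (ends-shE e))) (sym (cong proj₂ (ends-shE e)))
       (Conn-mono (≐⇒⊆ᴱ (combine-∖ L t e)) c))

slot-ends : ∀ {m} σ → ends (slotEdge {m} σ) ≡ (emb (end₁ σ) , emb (end₂ σ))
slot-ends rung = refl
slot-ends (link a b) = refl

Attached : ∀ {m} → Loc → EdgeSet m → Set
Attached L t = ∀ a → Conn (combine L t) (zero , a) h₀

SlotBridges : ∀ {m} → Loc → EdgeSet m → Set
SlotBridges L t = ∀ σ → entry L σ ≡ true → ¬ Conn (combine L t ∖ slotEdge σ) (emb (end₁ σ)) (emb (end₂ σ))

bridges-glue : ∀ {m} {L} {t : EdgeSet m} → SlotBridges L t →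
               (∀ e → t e ≡ true → ¬ Conn (combine L (t ∖ e)) (sh (proj₁ (ends e))) (sh (proj₂ (ends e)))) →
               Bridges (combine L t)
bridges-glue {L = L} {t} slot-br shifted-br = λ where
    (vert zero) We → slot-br rung We
    (horiz zero a b) We → slot-br (link a b) We
    (vert (suc i)) We → λ c → shifted-br (vert i) We (Conn-mono (≐⇒⊆ᴱ (≐-sym (combine-∖ L t (vert i)))) c)
    (horiz (suc i) a b) We → λ c →
      shifted-br (horiz i a b) We (Conn-mono (≐⇒⊆ᴱ (≐-sym (combine-∖ L t (horiz i a b)))) c)

glue-connected : ∀ {m} {L} {t : EdgeSet m} → Attached L t →
                 (∀ x → Conn (combine L t) (sh x) h₀) → Connected (combine L t)
glue-connected {L = L} {t} att rest-to-h₀ u v = to-h₀ u ◅◅ Conn-sym (to-h₀ v)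
  where
  to-h₀ : ∀ u → Conn (combine L t) u h₀
  to-h₀ (zero , a) = att a
  to-h₀ (suc i , a) = rest-to-h₀ (i , a)

joins-path : ∀ {m} L (t : EdgeSet m) → T (joins L) → Conn (combine L t) h₀ h₁
joins-path L t j = local-path L false {t} (λ ()) (reach-sound {local L false} {suc zero , false} {suc zero , true} j)

lift-joined : ∀ {m} {L} {t : EdgeSet m} → Conn (combine L t) h₀ h₁ →
              ∀ {x y} → Conn (addRung true t) x y → Conn (combine L t) (sh x) (sh y)
lift-joined {L = L} {t} joined = Star.concat ∘ Star.gmap sh step
  where
  step : ∀ {x y} → Adj (addRung true t) x y → Conn (combine L t) (sh x) (sh y)
  step (vert zero , _ , inj₁ refl) = joined
  step (vert zero , _ , inj₂ refl) = Conn-sym joined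
  step (vert (suc i) , te , p) = lift (combine-⊇ L t) ((vert (suc i) , te , p) ◅ ε)
  step (horiz i a b , te , p) = lift (combine-⊇ L t) ((horiz i a b , te , p) ◅ ε)

restrict : ∀ {m} {L} {t : EdgeSet m} → T (not (joins L)) → ∀ {x y} → Conn (combine L t) (sh x) (sh y) → Conn t x y
restrict {L = L} {t} ¬j c =
  Conn-mono (addRung-false t) (subst (λ b → Conn (addRung b t) _ _) (Equivalence.to T-not-≡ ¬j) (project {L = L} c))

restrict-joined : ∀ {m} {L} {t : EdgeSet m} → T (joins L) → ∀ {x y} → Conn (combine L t) (sh x) (sh y) →
                  Conn (addRung true t) x y
restrict-joined {L = L} {t} j c = subst (λ b → Conn (addRung b t) _ _) (T⇒≡ j) (project {L = L} c)

rest-tree : ∀ {m} {d} {D : Subset (suc m)} {L} {t : EdgeSet m} →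
            T (not (joins L)) → Tree (d ∷ D) (combine L t) → Tree D t
rest-tree {d = d} {D} {L} {t} ¬j (pres , conn , br) =
  (λ e te → trans (sym (present-shift d D e)) (pres (shE e) (combine-⊇ L t e te))) ,
  (λ x y → restrict ¬j (conn (sh x) (sh y))) ,
  (λ e te c → shifted-bridge e br te (lift (combine-⊇ L (t ∖ e)) c))

glue-tree : ∀ {m} {d} {D : Subset (suc m)} {L} {t : EdgeSet m} →
            T (not (joins L)) → T (not (entry L rung) ∨ not d) → Attached L t → SlotBridges L t →
            Tree D t → Tree (d ∷ D) (combine L t)
glue-tree {d = d} {D} {L} {t} ¬j rung-ok att slot-br (pres , conn , br) =
  present-ok ,
  glue-connected att (λ x → lift (combine-⊇ L t) (conn x j₀)) ,
  bridges-glue slot-br (λ e te c → br e te (restrict ¬j c))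
  where
  present-ok : PresentIn (d ∷ D) (combine L t)
  present-ok (vert zero) We = T⇒≡ (implies (entry L rung) rung-ok (≡⇒T We))
  present-ok (vert (suc i)) We = pres (vert i) We
  present-ok (horiz zero a b) _ = refl
  present-ok (horiz (suc i) a b) _ = refl

rest-forest : ∀ {m} {d} {D : Subset (suc m)} {L} {t : EdgeSet m} →
              T (joins L) → Tree (d ∷ D) (combine L t) → ¬ Conn t j₀ j₁ → SplitForest D t
rest-forest {D = _ ∷ D} {L} {t} j (pres , conn , br) apart =
  rung-absent , present-ok , (λ u v → restrict-joined j (conn (sh u) (sh v))) , bridges
  where
  rung-absent : t (vert zero) ≡ false
  rung-absent with t (vert zero) in te
  ... | true = ⊥-elim (apart ((vert zero , te , inj₁ refl) ◅ ε))
  ... | false = refl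
  present-ok : PresentIn (false ∷ D) (addRung true t)
  present-ok (vert zero) _ = refl
  present-ok (vert (suc i)) te = pres (vert (suc (suc i))) te
  present-ok (horiz i a b) _ = refl
  without-rung : (addRung true t ∖ vert zero) ⊆ᴱ t
  without-rung (vert (suc i)) q = trans (sym (∖-other (addRung true t) {vert zero} {vert (suc i)} (λ ()))) q
  without-rung (horiz i a b) q = trans (sym (∖-other (addRung true t) {vert zero} {horiz i a b} (λ ()))) q
  into : ∀ e → (addRung true t ∖ e) ⊆ᴱ addRung true (t ∖ e)
  into e (vert zero) _ = refl
  into e (vert (suc i)) q = q
  into e (horiz i a b) q = q
  bridges : Bridges (addRung true t)
  bridges (vert zero) _ c = apart (Conn-mono without-rung c)
  bridges e@(vert (suc i)) te c =
    shifted-bridge e br te (lift-joined (joins-path L (t ∖ e) j) (Conn-mono (into e) c))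
  bridges e@(horiz i a b) te c =
    shifted-bridge e br te (lift-joined (joins-path L (t ∖ e) j) (Conn-mono (into e) c))

glue-forest : ∀ {m} {d} {D : Subset (suc m)} {L} {t : EdgeSet m} →
              T (joins L) → T (not (entry L rung) ∨ not d) → Attached L t → (¬ Conn t j₀ j₁ → SlotBridges L t) →
              SplitForest D t → Tree (d ∷ D) (combine L t)
glue-forest {d = d} {D@(_ ∷ _)} {L} {t} j rung-ok att slot-br (rung-absent , pres , conn , br) =
  present-ok ,
  glue-connected att (λ x → lift-joined (joins-path L t j) (conn x j₀)) ,
  bridges-glue (slot-br apart) shifted
  where
  rung-in : t (vert zero) ≡ true → ⊥
  rung-in te with trans (sym rung-absent) te
  ... | ()
  apart : ¬ Conn t j₀ j₁
  apart c = br (vert zero) refl (Conn-mono avoids-rung c)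
    where
    avoids-rung : t ⊆ᴱ (addRung true t ∖ vert zero)
    avoids-rung (vert zero) te = ⊥-elim (rung-in te)
    avoids-rung (vert (suc i)) te = trans (∖-other (addRung true t) {vert zero} {vert (suc i)} (λ ())) te
    avoids-rung (horiz i a b) te = trans (∖-other (addRung true t) {vert zero} {horiz i a b} (λ ())) te
  present-ok : PresentIn (d ∷ D) (combine L t)
  present-ok (vert zero) We = T⇒≡ (implies (entry L rung) rung-ok (≡⇒T We))
  present-ok (vert (suc zero)) We = ⊥-elim (rung-in We)
  present-ok (vert (suc (suc i))) We = pres (vert (suc i)) We
  present-ok (horiz zero a b) _ = refl
  present-ok (horiz (suc i) a b) _ = refl
  keeps-rung : ∀ e → e ≢ vert zero → addRung true (t ∖ e) ⊆ᴱ (addRung true t ∖ e)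
  keeps-rung e e≢ (vert zero) _ = ∖-keeps (addRung true t) e (vert zero) refl (λ p → e≢ (sym p))
  keeps-rung e e≢ (vert (suc i)) q = q
  keeps-rung e e≢ (horiz i a b) q = q
  shifted : ∀ e → t e ≡ true → ¬ Conn (combine L (t ∖ e)) (sh (proj₁ (ends e))) (sh (proj₂ (ends e)))
  shifted (vert zero) te _ = rung-in te
  shifted e@(vert (suc i)) te c = br e te (Conn-mono (keeps-rung e (λ ())) (restrict-joined j c))
  shifted e@(horiz i a b) te c = br e te (Conn-mono (keeps-rung e (λ ())) (restrict-joined j c))

module _ {m} {L : Loc} {s : Bool} {t : EdgeSet m} where

  no-disconnection : Connected (combine L t) → (T (not s) → ¬ Conn t j₀ j₁) → T (not (disconnects L s))
  no-disconnection conn apart = refute (disconnects L s) λ d →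
    let x , cut = witness {xs = vertices₁} (λ x → separates (local L s) x (suc zero , false)) d
    in local-cut L s apart {x} {suc zero , false} cut (conn (emb x) h₀)

  no-cycle : Bridges (combine L t) → (T s → Conn t j₀ j₁) → T (not (closesCycle L s))
  no-cycle br joined = refute (closesCycle L s) λ c →
    let σ , w = witness {xs = slots} (λ σ → entry L σ ∧ reach (local (clear σ L) s) (end₁ σ) (end₂ σ)) c
        present , r = T-∧-split {entry L σ} w
    in br (slotEdge σ) (trans (combine-slot L t σ) (T⇒≡ present))
          (subst₂ (Conn _) (sym (cong proj₁ (slot-ends σ))) (sym (cong proj₂ (slot-ends σ)))
            (Conn-mono (≐⇒⊆ᴱ (≐-sym (remove-slot σ L t)))
              (local-path (clear σ L) s joined (reach-sound {local (clear σ L) s} {end₁ σ} {end₂ σ} r))))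

  tree⇒fits : ∀ {D} → Tree D (combine L t) → (T s → Conn t j₀ j₁) → (T (not s) → ¬ Conn t j₀ j₁) →
              T (fits L s)
  tree⇒fits (_ , conn , br) joined apart with T-∨-split {fits L s} (fits-or-obstructed L s)
  ... | inj₁ f = f
  ... | inj₂ obstructed with T-∨-split {disconnects L s} obstructed
  ...   | inj₁ d = ⊥-elim (T-not d (no-disconnection conn apart))
  ...   | inj₂ c = ⊥-elim (T-not c (no-cycle br joined))

  fits⇒attached : T (fits L s) → (T s → Conn t j₀ j₁) → Attached L t
  fits⇒attached f joined a =
    local-path L s joined (reach-sound {local L s} {zero , a} {suc zero , false}
      (all-at (λ x → reach (local L s) x (suc zero , false)) (proj₁ (T-∧-split {spans (local L s)} f))
              (∈-vertices₁ (zero , a))))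

  fits⇒bridges : T (fits L s) → (T (not s) → ¬ Conn t j₀ j₁) → SlotBridges L t
  fits⇒bridges f apart σ present c =
    local-cut (clear σ L) s apart {end₁ σ} {end₂ σ}
      (implies (entry L σ)
        (all-at (λ σ → not (entry L σ) ∨ separates (local (clear σ L) s) (end₁ σ) (end₂ σ))
          (proj₂ (T-∧-split {spans (local L s)} f)) (∈-slots σ))
        (≡⇒T present))
      (Conn-mono (≐⇒⊆ᴱ (remove-slot σ L t)) c)

-- The spanning trees of G^{d ∷ D} are obtained, without repetition, by
-- completing either a spanning tree or a split forest of G^D.

-- column-0 parts completing a spanning tree / a split forest of the rest;
-- p says whether the rung of column 0 is available
treeLocal forestLocal : Bool → Loc → Bool
treeLocal p L = (not (entry L rung) ∨ p) ∧ fits L true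
forestLocal p L = (not (entry L rung) ∨ p) ∧ fits L false

Completion : ∀ {m} → Bool → Subset (suc m) → Loc → EdgeSet m → Set
Completion p D L t = (T (treeLocal p L) × Tree D t) ⊎ (T (forestLocal p L) × SplitForest D t)

rung-usable : ∀ {m} {d} {D : Subset (suc m)} {L} {t : EdgeSet m} →
              PresentIn (d ∷ D) (combine L t) → T (not (entry L rung) ∨ not d)
rung-usable {d = d} {L = L} pres with entry L rung in e
... | false = _
... | true = ≡⇒T (pres (vert zero) e)

split : ∀ {m} {d} {D : Subset (suc m)} {L} {t : EdgeSet m} →
        Tree (d ∷ D) (combine L t) → Completion (not d) D L t
split {D = D} {L} {t} tree@(pres , _ , br) with joins L in j
... | false = inj₁ (T-∧-join (rung-usable pres) fitting , rest-is-tree)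
  where
  rest-is-tree : Tree D t
  rest-is-tree = rest-tree (Equivalence.from T-not-≡ j) tree
  fitting : T (fits L true)
  fitting = tree⇒fits {s = true} tree (λ _ → proj₁ (proj₂ rest-is-tree) j₀ j₁) (λ ())
... | true = inj₂ (T-∧-join (rung-usable pres) fitting , rest-forest (≡⇒T j) tree apart)
  where
  -- column 0 joins the sides, so a rest joining them too would close a cycle
  apart : ¬ Conn t j₀ j₁
  apart p = T-not (joins⇒cycle L (≡⇒T j)) (no-cycle {s = true} br (λ _ → p))
  fitting : T (fits L false)
  fitting = tree⇒fits {s = false} tree (λ ()) (λ _ → apart)

glue : ∀ {m} {d} {D : Subset (suc m)} {L} {t : EdgeSet m} →
       Completion (not d) D L t → Tree (d ∷ D) (combine L t)
glue {L = L} (inj₁ (local-ok , tree@(_ , conn , _))) with T-∧-split {not (entry L rung) ∨ _} local-ok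
... | rung-ok , f =
  glue-tree (fits-joined L f) rung-ok (fits⇒attached {s = true} f (λ _ → conn j₀ j₁))
            (fits⇒bridges {s = true} f (λ ())) tree
glue {L = L} (inj₂ (local-ok , forest)) with T-∧-split {not (entry L rung) ∨ _} local-ok
... | rung-ok , f =
  glue-forest (fits-apart L f) rung-ok (fits⇒attached {s = false} f (λ ()))
              (λ apart → fits⇒bridges {s = false} f (λ _ → apart)) forest

Resp : ∀ {n} → (EdgeSet n → Set) → Set
Resp {n} P = ∀ {E F : EdgeSet n} → E ≐ F → P E → P F

≐-trans : ∀ {n} {E F G : EdgeSet n} → E ≐ F → F ≐ G → E ≐ G
≐-trans E≐F F≐G e = trans (E≐F e) (F≐G e)

union-count : ∀ {n} {P Q R : EdgeSet n → Set} {k l} → NumberOf Q k → NumberOf R l →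
              (∀ {E F} → Q E → R F → ¬ E ≐ F) → (∀ E → P E → Q E ⊎ R E) → (∀ E → Q E ⊎ R E → P E) →
              NumberOf P (k + l)
union-count (Qs , Q-len , Q-all , Q-distinct , Q-complete) (Rs , R-len , R-all , R-distinct , R-complete)
            disjoint to from =
  Qs ++ Rs ,
  trans (length-++ Qs) (cong₂ _+_ Q-len R-len) ,
  AllP.++⁺ (All.map (λ q → from _ (inj₁ q)) Q-all) (All.map (λ r → from _ (inj₂ r)) R-all) ,
  AllPairsP.++⁺ Q-distinct R-distinct (All.map (λ q → All.map (disjoint q) R-all) Q-all) ,
  λ E PE → [ (λ q → AnyP.++⁺ˡ (Q-complete E q)) , (λ r → AnyP.++⁺ʳ Qs (R-complete E r)) ]′ (to E PE)

NumberOf-⇔ : ∀ {n} {P Q : EdgeSet n → Set} {k} → (∀ E → P E → Q E) → (∀ E → Q E → P E) →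
             NumberOf P k → NumberOf Q k
NumberOf-⇔ P⇒Q Q⇒P (Es , len , all-P , distinct , complete) =
  Es , len , All.map (P⇒Q _) all-P , distinct , λ E QE → complete E (Q⇒P E QE)

length-product : ∀ {A B C : Set} (f : A → B → C) xs ys → length (cartesianProductWith f xs ys) ≡ length xs * length ys
length-product f [] ys = refl
length-product f (x ∷ xs) ys =
  trans (length-++ (map (f x) ys)) (cong₂ _+_ (length-map (f x) ys) (length-product f xs ys))

all-product : ∀ {A B C : Set} {P : C → Set} (f : A → B → C) {xs ys} →
              All (λ x → All (λ y → P (f x y)) ys) xs → All P (cartesianProductWith f xs ys)
all-product f [] = []
all-product f (p ∷ ps) = AllP.++⁺ (AllP.map⁺ p) (all-product f ps)

distinct-product : ∀ {A B C : Set} {R : C → C → Set} (f : A → B → C) {xs ys} →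
                   AllPairs (λ x x' → ∀ y y' → R (f x y) (f x' y')) xs →
                   (∀ x → AllPairs (λ y y' → R (f x y) (f x y')) ys) →
                   AllPairs R (cartesianProductWith f xs ys)
distinct-product f [] _ = []
distinct-product f {x ∷ xs} {ys} (apart ∷ rest) within =
  AllPairsP.++⁺ (AllPairsP.map⁺ (within x)) (distinct-product f rest within)
    (AllP.map⁺ (All.tabulate λ {y} _ → all-product f (All.map (λ p → All.tabulate (λ {y'} _ → p y y')) apart)))

locsWith : (Loc → Bool) → List Loc
locsWith f = filter (λ L → T? (f L)) allLocs

countLocs : (Loc → Bool) → ℕ
countLocs f = length (locsWith f)

column₀-resp : ∀ {m} {E F : EdgeSet (suc m)} → E ≐ F → column₀ E ≡ column₀ F
column₀-resp E≐F = cong₂ _,_ (E≐F (vert zero)) (cong₂ _,_ (E≐F (horiz zero false false))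
  (cong₂ _,_ (E≐F (horiz zero false true)) (cong₂ _,_ (E≐F (horiz zero true false)) (E≐F (horiz zero true true)))))

product-count : ∀ {m} (f : Loc → Bool) {P : EdgeSet m → Set} {k} → Resp P → NumberOf P k →
                NumberOf (λ E → T (f (column₀ E)) × P (rest E)) (countLocs f * k)
product-count {m} f {P} P-resp (ts , len , P-all , distinct , complete) =
  cartesianProductWith combine (locsWith f) ts ,
  trans (length-product combine (locsWith f) ts) (cong (countLocs f *_) len) ,
  all-product combine (All.map (λ {L} fL → All.map (λ {t} Pt → local-ok {L} {t} fL , P-resp (≐-sym (rest-combine L t)) Pt)
                                                   P-all)
                               (AllP.all-filter (λ L → T? (f L)) allLocs)) ,
  distinct-product combine
    (AllPairsP.filter⁺ (λ L → T? (f L)) (AllPairs.map (λ L≢L' t t' eq → L≢L' (same-column eq)) unique-allLocs))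
    (λ L → AllPairs.map (λ t≉t' eq → t≉t' (same-rest eq)) distinct) ,
  λ E (fE , PE) → AnyP.cartesianProductWith⁺ combine (λ { refl t≐ → ≐-trans (decompose E) (combine-resp _ t≐) })
                    (∈-filter⁺ (λ L → T? (f L)) (∈-allLocs (column₀ E)) fE) (complete (rest E) PE)
  where
  local-ok : ∀ {L} {t : EdgeSet m} → T (f L) → T (f (column₀ (combine L t)))
  local-ok {L} {t} fL = subst (λ L → T (f L)) (sym (column₀-combine L t)) fL
  same-column : ∀ {L L' t t'} → combine L t ≐ combine L' t' → L ≡ L'
  same-column {L} {L'} {t} {t'} eq =
    trans (sym (column₀-combine L t)) (trans (column₀-resp eq) (column₀-combine L' t'))
  same-rest : ∀ {L t t'} → combine L t ≐ combine L t' → t ≐ t'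
  same-rest {L} {t} {t'} eq e = trans (sym (rest-combine L t e)) (trans (eq (shE e)) (rest-combine L t' e))

mutual
  trees : ∀ {m} → Subset (suc m) → ℕ
  trees (d ∷ []) = if d then 0 else 1
  trees (d ∷ D@(_ ∷ _)) = (if d then 4 else 8) * (trees D + splitForests D)

  splitForests : ∀ {m} → Subset (suc m) → ℕ
  splitForests (_ ∷ []) = 1
  splitForests (_ ∷ D@(_ ∷ _)) = 4 * (trees D + splitForests D)

withRung : Loc → Loc
withRung (_ , r) = true , r

addRung-decompose : ∀ {m} (E : EdgeSet (suc m)) → addRung true E ≐ combine (withRung (column₀ E)) (rest E)
addRung-decompose E (vert zero) = refl
addRung-decompose E (vert (suc i)) = refl
addRung-decompose E (horiz zero false false) = refl
addRung-decompose E (horiz zero false true) = refl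
addRung-decompose E (horiz zero true false) = refl
addRung-decompose E (horiz zero true true) = refl
addRung-decompose E (horiz (suc i) a b) = refl

addRung-resp : ∀ {m} b {E F : EdgeSet m} → E ≐ F → addRung b E ≐ addRung b F
addRung-resp b E≐F (vert zero) = cong (b ∨_) (E≐F (vert zero))
addRung-resp b E≐F (vert (suc i)) = E≐F (vert (suc i))
addRung-resp b E≐F (horiz i x y) = E≐F (horiz i x y)

SplitForest-resp : ∀ {m} {D : Subset (suc m)} → Resp (SplitForest D)
SplitForest-resp {D = _ ∷ _} E≐F (absent , tree) =
  trans (sym (E≐F (vert zero))) absent , Tree-resp (addRung-resp true E≐F) tree

splitTreeLocal splitForestLocal : Loc → Bool
splitTreeLocal L = not (entry L rung) ∧ treeLocal true (withRung L)
splitForestLocal L = not (entry L rung) ∧ forestLocal true (withRung L)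

completions-disjoint : ∀ {p q} {L L' : Loc} → L ≡ L' → T (treeLocal p L) → T (forestLocal q L') → ⊥
completions-disjoint {p} {q} {L} refl tl fl =
  T-not (fits-apart L (proj₂ (T-∧-split {not (entry L rung) ∨ q} fl)))
        (fits-joined L (proj₂ (T-∧-split {not (entry L rung) ∨ p} tl)))

G₀-tree : (E : EdgeSet 0) → E (vert zero) ≡ true → Tree (false ∷ []) E
G₀-tree E rung-in = (λ { (vert zero) _ → refl }) , connected , bridges
  where
  connected : Connected E
  connected (zero , false) (zero , false) = ε
  connected (zero , true) (zero , true) = ε
  connected (zero , false) (zero , true) = (vert zero , rung-in , inj₁ refl) ◅ ε
  connected (zero , true) (zero , false) = (vert zero , rung-in , inj₂ refl) ◅ ε
  bridges : Bridges E
  bridges (vert zero) _ ((vert zero , r , _) ◅ _) = case trans (sym (∧-zeroʳ (E (vert zero)))) r of λ ()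

G₀-rung : ∀ {E : EdgeSet 0} → Conn E j₀ j₁ → E (vert zero) ≡ true
G₀-rung ((vert zero , r , _) ◅ _) = r

Assembled : ∀ {m} → (Loc → Bool) → (EdgeSet m → Set) → EdgeSet (suc m) → Set
Assembled f P E = T (f (column₀ E)) × P (rest E)

tree-step : ∀ {m} d (D : Subset (suc m)) {A B} → NumberOf (Tree D) A → NumberOf (SplitForest D) B →
            NumberOf (Tree (d ∷ D)) (countLocs (treeLocal (not d)) * A + countLocs (forestLocal (not d)) * B)
tree-step d D trees-D forests-D =
  union-count (product-count (treeLocal (not d)) Tree-resp trees-D)
              (product-count (forestLocal (not d)) (SplitForest-resp {D = D}) forests-D)
              disjoint
              (λ E tree → split (Tree-resp (decompose E) tree))
              (λ E c → Tree-resp (≐-sym (decompose E)) (glue c))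
  where
  disjoint : ∀ {E F} → Assembled (treeLocal (not d)) (Tree D) E → Assembled (forestLocal (not d)) (SplitForest D) F →
             ¬ E ≐ F
  disjoint (tl , _) (fl , _) E≐F = completions-disjoint (column₀-resp E≐F) tl fl

-- split forests of G^{d ∷ D}: spanning trees of G^{false ∷ D} through the first rung, without it
forest-step : ∀ {m} d (D : Subset (suc m)) {A B} → NumberOf (Tree D) A → NumberOf (SplitForest D) B →
              NumberOf (SplitForest (d ∷ D)) (countLocs splitTreeLocal * A + countLocs splitForestLocal * B)
forest-step d D trees-D forests-D =
  union-count (product-count splitTreeLocal Tree-resp trees-D)
              (product-count splitForestLocal (SplitForest-resp {D = D}) forests-D)
              disjoint to from
  where
  disjoint : ∀ {E F} → Assembled splitTreeLocal (Tree D) E → Assembled splitForestLocal (SplitForest D) F → ¬ E ≐ F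
  disjoint {E} {F} (tl , _) (fl , _) E≐F =
    completions-disjoint {true} {true} (cong withRung (column₀-resp E≐F))
      (proj₂ (T-∧-split {not (E (vert zero))} tl)) (proj₂ (T-∧-split {not (F (vert zero))} fl))
  to : ∀ E → SplitForest (d ∷ D) E → Assembled splitTreeLocal (Tree D) E ⊎ Assembled splitForestLocal (SplitForest D) E
  to E (absent , tree) with split (Tree-resp (addRung-decompose E) tree)
  ... | inj₁ (tl , t) = inj₁ (T-∧-join (Equivalence.from T-not-≡ absent) tl , t)
  ... | inj₂ (fl , f) = inj₂ (T-∧-join (Equivalence.from T-not-≡ absent) fl , f)
  from : ∀ E → Assembled splitTreeLocal (Tree D) E ⊎ Assembled splitForestLocal (SplitForest D) E → SplitForest (d ∷ D) E
  from E (inj₁ (stl , t)) with T-∧-split {not (E (vert zero))} stl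
  ... | absent , tl = Equivalence.to T-not-≡ absent , Tree-resp (≐-sym (addRung-decompose E)) (glue (inj₁ (tl , t)))
  from E (inj₂ (sfl , f)) with T-∧-split {not (E (vert zero))} sfl
  ... | absent , fl = Equivalence.to T-not-≡ absent , Tree-resp (≐-sym (addRung-decompose E)) (glue (inj₂ (fl , f)))

counts : ∀ {m} (D : Subset (suc m)) → NumberOf (Tree D) (trees D) × NumberOf (SplitForest D) (splitForests D)
counts (false ∷ []) =
  ((λ _ → true) ∷ [] , refl , G₀-tree _ refl ∷ [] , [] ∷ [] ,
   λ E (_ , conn , _) → here λ { (vert zero) → G₀-rung (conn j₀ j₁) }) ,
  ((λ _ → false) ∷ [] , refl , (refl , G₀-tree _ refl) ∷ [] , [] ∷ [] ,
   λ E (absent , _) → here λ { (vert zero) → absent })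
counts (true ∷ []) =
  ([] , refl , [] , [] , λ E (pres , conn , _) → case pres (vert zero) (G₀-rung (conn j₀ j₁)) of λ ()) ,
  ((λ _ → false) ∷ [] , refl , (refl , G₀-tree _ refl) ∷ [] , [] ∷ [] ,
   λ E (absent , _) → here λ { (vert zero) → absent })
counts {suc m} (d ∷ D@(_ ∷ _)) with counts D
... | trees-D , forests-D =
  subst (NumberOf _) (coefficients d) (tree-step d D trees-D forests-D) ,
  subst (NumberOf _) (sym (ℕP.*-distribˡ-+ 4 (trees D) (splitForests D))) (forest-step d D trees-D forests-D)
  where
  coefficients : ∀ d → countLocs (treeLocal (not d)) * trees D + countLocs (forestLocal (not d)) * splitForests D
                       ≡ trees (d ∷ D)
  coefficients false = sym (ℕP.*-distribˡ-+ 8 (trees D) (splitForests D))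
  coefficients true = sym (ℕP.*-distribˡ-+ 4 (trees D) (splitForests D))

count-++ : ∀ {A : Set} (p : A → Bool) xs ys → countᵇ p (xs ++ ys) ≡ countᵇ p xs + countᵇ p ys
count-++ p [] ys = refl
count-++ p (x ∷ xs) ys with p x
... | true = cong suc (count-++ p xs ys)
... | false = count-++ p xs ys

count-map : ∀ {A B : Set} (p : B → Bool) (f : A → B) xs → countᵇ p (map f xs) ≡ countᵇ (p ∘ f) xs
count-map p f [] = refl
count-map p f (x ∷ xs) with p (f x)
... | true = cong suc (count-map p f xs)
... | false = count-map p f xs

count-cong : ∀ {A : Set} {p q : A → Bool} → (∀ x → p x ≡ q x) → ∀ xs → countᵇ p xs ≡ countᵇ q xs
count-cong p≗q [] = refl
count-cong {p = p} {q} p≗q (x ∷ xs) rewrite p≗q x with q x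
... | true = cong suc (count-cong p≗q xs)
... | false = count-cong p≗q xs

count-∷ : ∀ {A : Set} (p : A → Bool) x xs → countᵇ p (x ∷ xs) ≡ countᵇ p (x ∷ []) + countᵇ p xs
count-∷ p x xs with p x
... | true = refl
... | false = refl

links : ∀ {n} → Fin n → List (Edge n)
links i = horiz i false false ∷ horiz i false true ∷ horiz i true false ∷ horiz i true true ∷ []

columnEdges : ∀ {m} → List (Edge (suc m))
columnEdges = vert zero ∷ links zero

allEdges-suc : ∀ m → allEdges (suc m) ≡
  vert zero ∷ (map shE (map vert (allFin (suc m))) ++ (links zero ++ map shE (concatMap links (allFin m))))
allEdges-suc m = cong₂ (λ xs ys → vert zero ∷ (xs ++ (links zero ++ ys))) verticals horizontals
  where
  open ≡-Reasoning
  verticals : map vert (tabulate {n = suc m} suc) ≡ map shE (map vert (allFin (suc m)))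
  verticals = begin
    map vert (tabulate suc)                ≡⟨ map-tabulate suc vert ⟩
    tabulate (vert ∘ suc)                  ≡⟨ sym (map-tabulate id (shE ∘ vert)) ⟩
    map (shE ∘ vert) (allFin (suc m))      ≡⟨ map-∘ (allFin (suc m)) ⟩
    map shE (map vert (allFin (suc m)))    ∎
  horizontals : concatMap links (tabulate {n = m} suc) ≡ map shE (concatMap links (allFin m))
  horizontals = begin
    concat (map links (tabulate suc))                     ≡⟨ cong concat (map-tabulate suc links) ⟩
    concat (tabulate (links ∘ suc))                       ≡⟨ cong concat (sym (map-tabulate id (map shE ∘ links))) ⟩
    concat (map (map shE ∘ links) (allFin m))             ≡⟨ cong concat (map-∘ (allFin m)) ⟩
    concat (map (map shE) (map links (allFin m)))         ≡⟨ concat-map (map links (allFin m)) ⟩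
    map shE (concat (map links (allFin m)))               ∎

count-decompose : ∀ {m} (p : Edge (suc m) → Bool) →
                  countᵇ p (allEdges (suc m)) ≡ countᵇ p columnEdges + countᵇ (p ∘ shE) (allEdges m)
count-decompose {m} p = begin
  countᵇ p (allEdges (suc m))
    ≡⟨ cong (countᵇ p) (allEdges-suc m) ⟩
  countᵇ p (vert zero ∷ (map shE V ++ (links zero ++ map shE H)))
    ≡⟨ count-∷ p (vert zero) (map shE V ++ (links zero ++ map shE H)) ⟩
  c₀ + countᵇ p (map shE V ++ (links zero ++ map shE H))
    ≡⟨ cong (c₀ +_) (trans (count-++ p (map shE V) (links zero ++ map shE H))
                           (cong (countᵇ p (map shE V) +_) (count-++ p (links zero) (map shE H)))) ⟩
  c₀ + (countᵇ p (map shE V) + (countᵇ p (links zero) + countᵇ p (map shE H)))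
    ≡⟨ rearrange c₀ (countᵇ p (map shE V)) (countᵇ p (links zero)) (countᵇ p (map shE H)) ⟩
  (c₀ + countᵇ p (links zero)) + (countᵇ p (map shE V) + countᵇ p (map shE H))
    ≡⟨ cong₂ _+_ (sym (count-∷ p (vert zero) (links zero)))
                 (trans (cong₂ _+_ (count-map p shE V) (count-map p shE H)) (sym (count-++ (p ∘ shE) V H))) ⟩
  countᵇ p columnEdges + countᵇ (p ∘ shE) (allEdges m) ∎
  where
  open ≡-Reasoning
  V H : List (Edge m)
  V = map vert (allFin (suc m))
  H = concatMap links (allFin m)
  c₀ : ℕ
  c₀ = countᵇ p (vert zero ∷ [])
  rearrange : ∀ a b c d → a + (b + (c + d)) ≡ (a + c) + (b + d)
  rearrange = solve-∀

incident-shift : ∀ {m} (w : Vertex m) e → incident (sh w) (shE e) ≡ incident w e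
incident-shift (j , a) (vert i) = cong₂ (λ x y → if x then true else y) (same (i , false)) (same (i , true))
  where
  same : ∀ u → (sh (j , a) ==ᵥ sh u) ≡ ((j , a) ==ᵥ u)
  same (i , b) = cong (_∧ ⌊ a Bool.≟ b ⌋) (⌊⌋-map′ _ _ (j Fin.≟ i))
incident-shift (j , a) (horiz i b c) = cong₂ (λ x y → if x then true else y) (same (Fin.inject₁ i , b)) (same (suc i , c))
  where
  same : ∀ u → (sh (j , a) ==ᵥ sh u) ≡ ((j , a) ==ᵥ u)
  same (i , b) = cong (_∧ ⌊ a Bool.≟ b ⌋) (⌊⌋-map′ _ _ (j Fin.≟ i))

count-none : ∀ {A : Set} (xs : List A) → countᵇ (λ _ → false) xs ≡ 0
count-none [] = refl
count-none (_ ∷ xs) = count-none xs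

degree-shift : ∀ {m} d (D : Subset (suc m)) w →
               degree (d ∷ D) (sh w) ≡ countᵇ (λ e → present (d ∷ D) e ∧ incident (sh w) e) columnEdges + degree D w
degree-shift {m} d D w =
  trans (count-decompose P)
        (cong (countᵇ P columnEdges +_) (count-cong (λ e → cong₂ _∧_ (present-shift d D e) (incident-shift w e)) (allEdges m)))
  where
  P : Edge (suc m) → Bool
  P e = present (d ∷ D) e ∧ incident (sh w) e

degree-first : ∀ {m} d (D : Subset (suc m)) → degree (d ∷ D) v₁ ≡ (if d then 2 else 3)
degree-first {m} d D =
  trans (count-decompose P)
        (trans (cong (countᵇ P columnEdges +_) (trans (count-cong far (allEdges m)) (count-none (allEdges m)))) (near d))
  where
  P : Edge (suc m) → Bool
  P e = present (d ∷ D) e ∧ incident v₁ e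
  far : ∀ e → present (d ∷ D) (shE e) ∧ incident v₁ (shE e) ≡ false
  far (vert i) = ∧-zeroʳ (present (d ∷ D) (shE (vert i)))
  far (horiz i a b) = ∧-zeroʳ true
  near : ∀ d → countᵇ (λ e → present (d ∷ D) e ∧ incident v₁ e) columnEdges + 0 ≡ (if d then 2 else 3)
  near false = refl
  near true = refl

lastBit : ∀ {m} → Subset (suc m) → Bool
lastBit (d ∷ []) = d
lastBit (_ ∷ D@(_ ∷ _)) = lastBit D

degree-last : ∀ {m} (D : Subset (suc (suc m))) → degree D vₙ₊₁ ≡ (if lastBit D then 2 else 3)
degree-last {zero} (false ∷ false ∷ []) = refl
degree-last {zero} (false ∷ true ∷ []) = refl
degree-last {zero} (true ∷ false ∷ []) = refl
degree-last {zero} (true ∷ true ∷ []) = refl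
degree-last {suc m} (d ∷ D@(_ ∷ _)) = trans (degree-shift d D (vₙ₊₁ {suc m})) (cong₂ _+_ (far d) (degree-last D))
  where
  far : ∀ d → countᵇ (λ e → present (d ∷ D) e ∧ incident (sh (vₙ₊₁ {suc m})) e) columnEdges ≡ 0
  far false = refl
  far true = refl

bit : Bool → ℕ
bit b = if b then 1 else 0

size : ∀ {m} d (D : Subset m) → ∣ d ∷ D ∣ ≡ bit d + ∣ D ∣
size false D = refl
size true D = refl

-- trees plus split forests: every rung but the last contributes a factor
-- 12 (if present) or 8 (if deleted), the last one a factor 2 or 1
closed-form : ∀ {m} (D : Subset (suc m)) →
              (trees D + splitForests D) * 3 ^ ∣ D ∣ * 4 ^ bit (lastBit D)
                ≡ 2 ^ (1 + 2 * m + ∣ D ∣) * 3 ^ m * 3 ^ bit (lastBit D)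
closed-form (false ∷ []) = refl
closed-form (true ∷ []) = refl
closed-form {suc m} (false ∷ D@(_ ∷ _)) = begin
  (8 * S + 4 * S) * R * W                           ≡⟨ regroup S R W ⟩
  12 * (S * R * W)                                  ≡⟨ cong (12 *_) (closed-form D) ⟩
  12 * (2 ^ (1 + 2 * m + ∣ D ∣) * 3 ^ m * Z)        ≡⟨ expand (2 ^ (1 + 2 * m + ∣ D ∣)) (3 ^ m) Z ⟩
  2 ^ (2 + (1 + 2 * m + ∣ D ∣)) * 3 ^ suc m * Z      ≡⟨ cong (λ k → 2 ^ k * 3 ^ suc m * Z) (exponent m ∣ D ∣) ⟩
  2 ^ (1 + 2 * suc m + ∣ D ∣) * 3 ^ suc m * Z        ∎
  where
  open ≡-Reasoning
  S R W Z : ℕ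
  S = trees D + splitForests D
  R = 3 ^ ∣ D ∣
  W = 4 ^ bit (lastBit D)
  Z = 3 ^ bit (lastBit D)
  regroup : ∀ S R W → (8 * S + 4 * S) * R * W ≡ 12 * (S * R * W)
  regroup = solve-∀
  expand : ∀ X Y Z → 12 * (X * Y * Z) ≡ 2 * (2 * X) * (3 * Y) * Z
  expand = solve-∀
  exponent : ∀ m r → 2 + (1 + 2 * m + r) ≡ 1 + 2 * suc m + r
  exponent = solve-∀
closed-form {suc m} (true ∷ D@(_ ∷ _)) = begin
  (4 * S + 4 * S) * (3 * R) * W                     ≡⟨ regroup S R W ⟩
  24 * (S * R * W)                                  ≡⟨ cong (24 *_) (closed-form D) ⟩
  24 * (2 ^ (1 + 2 * m + ∣ D ∣) * 3 ^ m * Z)        ≡⟨ expand (2 ^ (1 + 2 * m + ∣ D ∣)) (3 ^ m) Z ⟩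
  2 ^ (3 + (1 + 2 * m + ∣ D ∣)) * 3 ^ suc m * Z      ≡⟨ cong (λ k → 2 ^ k * 3 ^ suc m * Z) (exponent m ∣ D ∣) ⟩
  2 ^ (1 + 2 * suc m + suc ∣ D ∣) * 3 ^ suc m * Z    ∎
  where
  open ≡-Reasoning
  S R W Z : ℕ
  S = trees D + splitForests D
  R = 3 ^ ∣ D ∣
  W = 4 ^ bit (lastBit D)
  Z = 3 ^ bit (lastBit D)
  regroup : ∀ S R W → (4 * S + 4 * S) * (3 * R) * W ≡ 24 * (S * R * W)
  regroup = solve-∀
  expand : ∀ X Y Z → 24 * (X * Y * Z) ≡ 2 * (2 * (2 * X)) * (3 * Y) * Z
  expand = solve-∀
  exponent : ∀ m r → 3 + (1 + 2 * m + r) ≡ 1 + 2 * suc m + suc r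
  exponent = solve-∀

endDegree : Bool → ℕ
endDegree b = if b then 2 else 3

power-split : ∀ base x y z → x ≡ y + z → base ^ x ≡ base ^ y * base ^ z
power-split base x y z refl = ℕP.^-distribˡ-+-* base y z

end-constants : ∀ d l → (if d then 4 else 8) * 2 ^ 10 * 3 ^ (bit d + (endDegree d + endDegree l)) * 3 ^ bit l
                          ≡ 2 ^ (1 + bit d + 2 * (endDegree d + endDegree l)) * 3 ^ 6 * 4 ^ bit l
end-constants false false = refl
end-constants false true = refl
end-constants true false = refl
end-constants true true = refl

-- the formula of the theorem from the closed form of the rest: after multiplying
-- both sides by 4 ^ bit l it reduces to the numerical identity end-constants
end-columns : ∀ m ρ S d l → S * 3 ^ ρ * 4 ^ bit l ≡ 2 ^ (1 + 2 * m + ρ) * 3 ^ m * 3 ^ bit l →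
              ((if d then 4 else 8) * S) * 2 ^ 10 * 3 ^ ((bit d + ρ) + (endDegree d + endDegree l))
                ≡ 2 ^ (2 * suc m + (bit d + ρ) + 2 * (endDegree d + endDegree l)) * 3 ^ (suc m + 5)
end-columns m ρ S d l closed = ℕP.*-cancelʳ-≡ _ _ (4 ^ bit l) {{ℕP.m^n≢0 4 (bit l)}} (begin
  c * S * 2 ^ 10 * 3 ^ ((δ + ρ) + k) * a
    ≡⟨ cong (λ x → c * S * 2 ^ 10 * x * a) (power-split 3 ((δ + ρ) + k) ρ (δ + k) (swap δ ρ k)) ⟩
  c * S * 2 ^ 10 * (3 ^ ρ * 3 ^ (δ + k)) * a
    ≡⟨ regroup c S (2 ^ 10) (3 ^ ρ) (3 ^ (δ + k)) a ⟩
  (c * 2 ^ 10 * 3 ^ (δ + k)) * (S * 3 ^ ρ * a)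
    ≡⟨ cong ((c * 2 ^ 10 * 3 ^ (δ + k)) *_) closed ⟩
  (c * 2 ^ 10 * 3 ^ (δ + k)) * (X * Y * b)
    ≡⟨ regroup′ (c * 2 ^ 10 * 3 ^ (δ + k)) X Y b ⟩
  (c * 2 ^ 10 * 3 ^ (δ + k) * b) * (X * Y)
    ≡⟨ cong (_* (X * Y)) (end-constants d l) ⟩
  (2 ^ (1 + δ + 2 * k) * 3 ^ 6 * a) * (X * Y)
    ≡⟨ regroup″ (2 ^ (1 + δ + 2 * k)) (3 ^ 6) a X Y ⟩
  X * 2 ^ (1 + δ + 2 * k) * (Y * 3 ^ 6) * a
    ≡⟨ cong₂ (λ x y → x * y * a) (sym (power-split 2 _ (1 + 2 * m + ρ) (1 + δ + 2 * k) (exponent₂ m ρ δ k)))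
                                  (sym (power-split 3 (suc m + 5) m 6 (exponent₃ m))) ⟩
  2 ^ (2 * suc m + (δ + ρ) + 2 * k) * 3 ^ (suc m + 5) * a ∎)
  where
  open ≡-Reasoning
  c δ k a b X Y : ℕ
  c = if d then 4 else 8
  δ = bit d
  k = endDegree d + endDegree l
  a = 4 ^ bit l
  b = 3 ^ bit l
  X = 2 ^ (1 + 2 * m + ρ)
  Y = 3 ^ m
  swap : ∀ δ ρ k → (δ + ρ) + k ≡ ρ + (δ + k)
  swap = solve-∀
  exponent₂ : ∀ m ρ δ k → 2 * suc m + (δ + ρ) + 2 * k ≡ (1 + 2 * m + ρ) + (1 + δ + 2 * k)
  exponent₂ = solve-∀
  exponent₃ : ∀ m → suc m + 5 ≡ m + 6
  exponent₃ = solve-∀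
  regroup : ∀ c S p R q a → c * S * p * (R * q) * a ≡ (c * p * q) * (S * R * a)
  regroup = solve-∀
  regroup′ : ∀ K X Y b → K * (X * Y * b) ≡ (K * b) * (X * Y)
  regroup′ = solve-∀
  regroup″ : ∀ p q a X Y → (p * q * a) * (X * Y) ≡ X * p * (Y * q) * a
  regroup″ = solve-∀

-- Theorem 4.4. With D = d ∷ D′ the spanning trees of G^D are counted by
-- trees D; the closed form of trees D′ + splitForests D′ and the degrees of
-- the end vertices turn the recurrence step into the stated formula.
theorem4p4 : (n r : ℕ) → 1 ≤ n → r ≤ suc n → (D : Subset (suc n)) → ∣ D ∣ ≡ r →
    Σ ℕ λ τ → NumberOf (SpanningTree D) τ ×
      τ * 2 ^ 10 * 3 ^ (r + (degree D v₁ + degree D vₙ₊₁))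
        ≡ 2 ^ (2 * n + r + 2 * (degree D v₁ + degree D vₙ₊₁)) * 3 ^ (n + 5)
theorem4p4 (suc m) _ _ _ (d ∷ D@(_ ∷ _)) refl
  rewrite degree-first d D | degree-last (d ∷ D) | size d D =
  trees (d ∷ D) ,
  NumberOf-⇔ (λ _ → Tree⇒SpanningTree) (λ _ → SpanningTree⇒Tree) (proj₁ (counts (d ∷ D))) ,
  end-columns m ∣ D ∣ (trees D + splitForests D) d (lastBit D) (closed-form D)
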